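{- For $n\ge 1$, $a_n(12;3\to 1)=C_n$, the $n$-th Catalan number.
   Context: Standard cycle form of $\sigma\in S_n$: product of disjoint cycles (fixed points included), each cycle starting with its largest element, cycles listed in increasing order of largest elements. The fundamental bijection $\theta:S_n\to S_n$ erases the parentheses of the standard cycle form to give a one-line permutation. For $\pi\in S_n$, $\hat\pi=\theta^{ -1}(\pi)$. An arrow pattern $(\nu;H)$ of size $k$: a string $\nu=a_1\dots a_m$ of positive integers and a set $H$ of arrows $b\to c$, with all integers appearing forming $[k]$. $\pi\in S_n$ contains $(\nu;H)$ if there is $X=\{x_1<\dots<x_k\}\subseteq[n]$ with positions $t_1<\dots<t_m$ such that $\pi_{t_1}\cdots\pi_{t_m}=x_{a_1}\cdots x_{a_m}$ and $\hat\pi(x_b)=x_c$ for every arrow $b\to c\in H$; otherwise it avoids it. $a_n(\nu;H)$ = number of $\pi\in S_n$ avoiding $(\nu;H)$. $C_n=\frac{1}{n+1}\binom{2n}{n}$. -}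

module Defs where

open import Data.Nat using (ℕ; zero; suc; _+_; _*_; _∸_; _/_; _≡ᵇ_; _≤ᵇ_)
open import Data.Nat.Combinatorics using (_C_)
open import Data.Bool using (Bool; true; false; _∧_; _∨_; not; if_then_else_)
open import Data.List using (List; []; _∷_; _++_; map; concatMap; upTo; filterᵇ; length; foldr)
open import Data.Bool.ListAction using (all; any)
open import Data.Product using (_×_; _,_)

-- Conventions: [n] is represented by {0,…,n-1} (an order-isomorphic relabelling).
-- A permutation of [n] is represented in one-line notation as a list
-- π = π(0) π(1) … π(n-1).

-- value at index i of a list (default 0 if out of range)
at : List ℕ → ℕ → ℕ
at []       _       = 0
at (x ∷ xs) zero    = x
at (x ∷ xs) (suc i) = at xs i

elemᵇ : ℕ → List ℕ → Bool
elemᵇ x = any (λ y → x ≡ᵇ y)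

distinctᵇ : List ℕ → Bool
distinctᵇ []       = true
distinctᵇ (x ∷ xs) = not (elemᵇ x xs) ∧ distinctᵇ xs

allLists : ℕ → ℕ → List (List ℕ)
allLists n zero    = [] ∷ []
allLists n (suc l) = concatMap (λ x → map (x ∷_) (allLists n l)) (upTo n)

perms : ℕ → List (List ℕ)
perms n = filterᵇ distinctᵇ (allLists n n)

orbitFrom : ℕ → List ℕ → ℕ → ℕ → List ℕ
orbitFrom zero       σ m x = []
orbitFrom (suc fuel) σ m x =
  if x ≡ᵇ m then [] else x ∷ orbitFrom fuel σ m (at σ x)

orbit : List ℕ → ℕ → List ℕ
orbit σ m = m ∷ orbitFrom (length σ) σ m (at σ m)

isCycleMax : List ℕ → ℕ → Bool
isCycleMax σ m = all (λ y → y ≤ᵇ m) (orbit σ m)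

standardCycleForm : List ℕ → List (List ℕ)
standardCycleForm σ =
  map (orbit σ) (filterᵇ (isCycleMax σ) (upTo (length σ)))

θ : List ℕ → List ℕ
θ σ = foldr _++_ [] (standardCycleForm σ)

-- Arrow patterns (ν ; H) of size k: ν a string of positive integers,
-- H a list of arrows b → c (given as pairs (b , c)); integers in [k] (1-based).
record ArrowPattern : Set where
  constructor pat
  field
    size   : ℕ
    word   : List ℕ
    arrows : List (ℕ × ℕ)

choose : ℕ → List ℕ → List (List ℕ)
choose zero    _        = [] ∷ []
choose (suc k) []       = []
choose (suc k) (x ∷ xs) = map (x ∷_) (choose k xs) ++ choose (suc k) xs

isSubseqᵇ : List ℕ → List ℕ → Bool
isSubseqᵇ []       _        = true
isSubseqᵇ (w ∷ ws) []       = false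
isSubseqᵇ (w ∷ ws) (p ∷ ps) =
  if w ≡ᵇ p then isSubseqᵇ ws ps else isSubseqᵇ (w ∷ ws) ps

-- x_a for 1-based a, where X = x₁ < … < x_k is given as a list
xAt : List ℕ → ℕ → ℕ
xAt X a = at X (a ∸ 1)

-- π (in S_n, n = length π) contains (ν;H): there is X = {x₁<…<x_k} ⊆ [n]
-- such that x_{a₁}…x_{a_m} occurs as a subsequence of π, and
-- π̂(x_b) = x_c for every arrow b → c, where π̂ = θ⁻¹(π), i.e. the
-- (unique) σ ∈ S_n with θ(σ) = π.
containsᵇ : List ℕ → ArrowPattern → Bool
containsᵇ π (pat k ν H) =
  any (λ σ →
        listEq (θ σ) π ∧
        any (λ X →
              isSubseqᵇ (map (xAt X) ν) π ∧
              all (λ { (b , c) → at σ (xAt X b) ≡ᵇ xAt X c }) H)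
            (choose k (upTo n)))
      (perms n)
  where
    n = length π
    listEq : List ℕ → List ℕ → Bool
    listEq []       []       = true
    listEq (x ∷ xs) (y ∷ ys) = (x ≡ᵇ y) ∧ listEq xs ys
    listEq _        _        = false

avoidsᵇ : List ℕ → ArrowPattern → Bool
avoidsᵇ π p = not (containsᵇ π p)

a : ℕ → ArrowPattern → ℕ
a n p = length (filterᵇ (λ π → avoidsᵇ π p) (perms n))

catalan : ℕ → ℕ
catalan n = ((2 * n) C n) / suc n

pat12-3→1 : ArrowPattern
pat12-3→1 = pat 3 (1 ∷ 2 ∷ []) ((3 , 1) ∷ [])

module Submission where

-- Writing π = θ(π̂), the cycles of π̂ are the blocks of π that begin at its left-to-right maxima,
-- and π̂ sends each entry of a block to the next one (the last entry back to the block's head).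
-- So an arrow x₃ → x₁ with x₁ < x₃ is exactly an adjacent descent x₃ x₁ of π, and π contains
-- (12 ; 3 → 1) iff some adjacent descent x₃ x₁ is followed by an x₂ with x₁ < x₂ < x₃, that is,
-- iff π contains 312.  312-avoiders are counted prefix by prefix: a viable prefix has as many
-- completions as a ballot number indexed by i, the number of unused values above its maximum, and
-- j, the number of unused values below it, because the next entry is either the largest unused
-- value below the maximum or a new maximum.  The ballot number at (n , 0) is C(2n,n) − C(2n,n+1).

open import Data.Bool using (Bool; true; false; T; _∧_; if_then_else_)
open import Data.Bool.ListAction using (any; all)
open import Data.Bool.Properties using (T-∧)
open import Data.Empty using (⊥; ⊥-elim)
open import Data.List
  using (List; []; _∷_; _++_; [_]; map; concat; concatMap; upTo; applyUpTo; length; filter; filterᵇ; foldr)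
open import Data.List.Membership.Propositional using (_∈_; _∉_; find; lose)
open import Data.List.Membership.Propositional.Properties
  using ( ∈-++⁺ˡ; ∈-++⁺ʳ; ∈-++⁻; ∈-∃++; ∈-concat⁻′; ∈-map⁺; ∈-map⁻; ∈-upTo⁺; ∈-upTo⁻
        ; ∈-filter⁺; ∈-filter⁻; ∈-concatMap⁺; ∈-concatMap⁻)
open import Data.List.Properties
  using ( map-++; map-∘; map-cong-local; length-++; length-++-sucʳ; length-++-≤ˡ; length-++-≤ʳ; length-upTo; length-map
        ; concat-++; ++-assoc; ++-identityʳ; filter-++; filter-accept; filter-none)
open import Data.List.Relation.Binary.Permutation.Propositional using (_↭_; ↭-refl; ↭-sym; ↭⇒↭ₛ; module PermutationReasoning)
open import Data.List.Relation.Binary.Permutation.Propositional.Properties using (∷↭∷ʳ; ∈-resp-↭) renaming (++⁺ to ↭-++⁺)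
import Data.List.Relation.Binary.Sublist.Propositional as Sublist
open import Data.List.Relation.Binary.Sublist.Propositional using (_⊆_; []; _∷_; _∷ʳ_; minimum; ⊆-refl; from∈; to∈)
open import Data.List.Relation.Binary.Sublist.Propositional.Properties using (All-resp-⊆; filter-⊆; ∷ˡ⁻; ++⁺)
open import Data.List.Relation.Unary.All as All using (All; []; _∷_)
open import Data.List.Relation.Unary.All.Properties
  using (¬Any⇒All¬; All¬⇒¬Any; all⁺; all⁻) renaming (++⁺ to All-++⁺; ++⁻ˡ to All-++⁻ˡ; map⁺ to All-map⁺)
open import Data.List.Relation.Unary.AllPairs using (AllPairs; []; _∷_)
import Data.List.Relation.Unary.AllPairs.Properties as AllPairs
open import Data.List.Relation.Unary.Any as Any using (Any; here; there)
open import Data.List.Relation.Unary.Any.Properties using (any⁺; any⁻)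
open import Data.List.Relation.Unary.Unique.Propositional using (Unique)
open import Data.List.Relation.Unary.Unique.Propositional.Properties using (upTo⁺) renaming (++⁺ to Unique-++⁺)
open import Data.Nat using (ℕ; zero; suc; _+_; _*_; _∸_; _/_; _⊔_; _≤_; _<_; _≤?_; _≡ᵇ_; _≤ᵇ_; s≤s; s≤s⁻¹; z≤n)
open import Data.Nat.Combinatorics using (_C_; nCn≡1; nC1≡n; nCk≡nC[n∸k]; nCk+nC[k+1]≡[n+1]C[k+1]; k>n⇒nCk≡0)
open import Data.Nat.DivMod using (m*n/n≡m)
open import Data.Nat.Properties
open import Data.Nat.Tactic.RingSolver using (solve-∀)
open import Data.Product using (Σ; ∃₂; ∃-syntax; _×_; _,_; proj₁; proj₂)
open import Data.Sum using (_⊎_; inj₁; inj₂; [_,_]′)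
open import Function using (_∘_; _⇔_; mk⇔; Equivalence)
open import Level using (0ℓ)
open import Relation.Binary.Definitions using (tri<; tri≈; tri>)
open import Relation.Binary.PropositionalEquality
  using (_≡_; _≢_; ≢-sym; refl; sym; trans; cong; cong₂; subst; subst₂; setoid; module ≡-Reasoning)
open import Relation.Nullary using (¬_; yes; no; does; T?; ¬?; _×-dec_)
open import Relation.Nullary.Decidable using (map′)
open import Relation.Unary using (Pred; Decidable)
open import Relation.Unary.Properties using (_∩?_)

open import Algebra.Properties.CommutativeSemigroup +-commutativeSemigroup using (interchange; x∙yz≈y∙xz)
open import Data.List.Membership.DecPropositional _≟_ using (_∈?_)
open import Data.List.Relation.Binary.Permutation.Setoid.Properties (setoid ℕ) using (Unique-resp-↭)
open import Data.List.Relation.Unary.Unique.DecPropositional _≟_ using (unique?)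

open import Defs


-- Ballot numbers and Catalan numbers

∑< : ℕ → (ℕ → ℕ) → ℕ
∑< zero    f = 0
∑< (suc n) f = f 0 + ∑< n (f ∘ suc)

∑<-cong : ∀ n {f g} → (∀ {t} → t < n → f t ≡ g t) → ∑< n f ≡ ∑< n g
∑<-cong zero    f≗g = refl
∑<-cong (suc n) f≗g = cong₂ _+_ (f≗g (s≤s z≤n)) (∑<-cong n (f≗g ∘ s≤s))

∑<-+ : ∀ a b f → ∑< (a + b) f ≡ ∑< a f + ∑< b (λ t → f (a + t))
∑<-+ zero    b f = refl
∑<-+ (suc a) b f = trans (cong (f 0 +_) (∑<-+ a b (f ∘ suc))) (sym (+-assoc (f 0) _ _))

∑<-zero : ∀ n {f} → (∀ {t} → t < n → f t ≡ 0) → ∑< n f ≡ 0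
∑<-zero zero    _   = refl
∑<-zero (suc n) f≗0 = cong₂ _+_ (f≗0 (s≤s z≤n)) (∑<-zero n (f≗0 ∘ s≤s))

∑<-single : ∀ n {f x} → x < n → (∀ {t} → t < n → t ≢ x → f t ≡ 0) → ∑< n f ≡ f x
∑<-single (suc n) {f} {zero} _ others≡0 =
  trans (cong (f 0 +_) (∑<-zero n (λ t<n → others≡0 (s≤s t<n) λ ()))) (+-identityʳ (f 0))
∑<-single (suc n) {f} {suc x} (s≤s x<n) others≡0 =
  trans (cong (_+ ∑< n (f ∘ suc)) (others≡0 (s≤s z≤n) λ ()))
        (∑<-single n x<n λ t<n t≢x → others≡0 (s≤s t<n) (t≢x ∘ suc-injective))

ballot : ℕ → ℕ → ℕ
ballot zero    j       = 1
ballot (suc i) zero    = ballot i 1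
ballot (suc i) (suc j) = ballot (suc i) j + ballot i (suc (suc j))

newMaxSum : ℕ → ℕ → ℕ
newMaxSum i j = ∑< i (λ t → ballot (i ∸ suc t) (j + t))

newMaxSum-suc : ∀ i j → newMaxSum (suc i) j ≡ ballot i (suc j)
newMaxSum-suc zero    j = refl
newMaxSum-suc (suc i) j = begin
  ballot (suc i) (j + 0) + ∑< (suc i) (λ t → ballot (i ∸ t) (j + suc t))
    ≡⟨ cong₂ _+_ (cong (ballot (suc i)) (+-identityʳ j))
                 (∑<-cong (suc i) (λ {t} _ → cong (ballot (i ∸ t)) (+-suc j t))) ⟩
  ballot (suc i) j + newMaxSum (suc i) (suc j)
    ≡⟨ cong (ballot (suc i) j +_) (newMaxSum-suc i (suc j)) ⟩
  ballot (suc i) (suc j) ∎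
  where open ≡-Reasoning

ballot-suc : ∀ i j → ballot i (suc j) ≡ ballot i j + newMaxSum i (suc j)
ballot-suc zero    j = refl
ballot-suc (suc i) j = cong (ballot (suc i) j +_) (sym (newMaxSum-suc i (suc j)))

pascal : ∀ m k → suc m C suc k ≡ m C k + m C suc k
pascal m k = sym (nCk+nC[k+1]≡[n+1]C[k+1] m k)

central-symmetric : ∀ k → (k + suc k) C suc k ≡ (k + suc k) C k
central-symmetric k = begin
  (k + suc k) C suc k              ≡⟨ cong ((k + suc k) C_) (sym (m+n∸m≡n k (suc k))) ⟩
  (k + suc k) C (k + suc k ∸ k)    ≡⟨ sym (nCk≡nC[n∸k] (m≤m+n k (suc k))) ⟩
  (k + suc k) C k                  ∎
  where open ≡-Reasoning

ballot-binomial : ∀ i j m k → i + k ≡ m → i + j ≡ k → ballot i j + m C suc k ≡ m C k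
ballot-binomial zero j m k refl refl = begin
  1 + k C suc k  ≡⟨ cong suc (k>n⇒nCk≡0 (n<1+n k)) ⟩
  1              ≡⟨ sym (nCn≡1 k) ⟩
  k C k          ∎
  where open ≡-Reasoning
ballot-binomial (suc i) zero (suc m) (suc k) 1+i+1+k≡1+m 1+i+0≡1+k
  with refl ← trans (sym (+-identityʳ i)) (suc-injective 1+i+0≡1+k)
  with refl ← suc-injective 1+i+1+k≡1+m = begin
  ballot i 1 + suc m C suc (suc i)            ≡⟨ cong (ballot i 1 +_) (pascal m (suc i)) ⟩
  ballot i 1 + (m C suc i + m C suc (suc i))  ≡⟨ x∙yz≈y∙xz (ballot i 1) (m C suc i) _ ⟩
  m C suc i + (ballot i 1 + m C suc (suc i))  ≡⟨ cong (m C suc i +_) (ballot-binomial i 1 m (suc i) refl i+1≡1+i) ⟩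
  m C suc i + m C suc i                       ≡⟨ cong (_+ m C suc i) (central-symmetric i) ⟩
  m C i + m C suc i                           ≡⟨ sym (pascal m i) ⟩
  suc m C suc i                               ∎
  where
  open ≡-Reasoning
  i+1≡1+i : i + 1 ≡ suc i
  i+1≡1+i = +-comm i 1
ballot-binomial (suc i) (suc j) (suc m) (suc k) 1+i+1+k≡1+m 1+i+1+j≡1+k = begin
  (ballot (suc i) j + ballot i (2 + j)) + suc m C suc (suc k)
    ≡⟨ cong (ballot (suc i) j + ballot i (2 + j) +_) (pascal m (suc k)) ⟩
  (ballot (suc i) j + ballot i (2 + j)) + (m C suc k + m C suc (suc k))
    ≡⟨ interchange (ballot (suc i) j) (ballot i (2 + j)) (m C suc k) _ ⟩
  (ballot (suc i) j + m C suc k) + (ballot i (2 + j) + m C suc (suc k))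
    ≡⟨ cong₂ _+_ (ballot-binomial (suc i) j m k 1+i+k≡m 1+i+j≡k) (ballot-binomial i (2 + j) m (suc k) i+1+k≡m i+2+j≡1+k) ⟩
  m C k + m C suc k
    ≡⟨ sym (pascal m k) ⟩
  suc m C suc k ∎
  where
  open ≡-Reasoning
  i+1+k≡m : i + suc k ≡ m
  i+1+k≡m = suc-injective 1+i+1+k≡1+m
  1+i+k≡m : suc i + k ≡ m
  1+i+k≡m = trans (sym (+-suc i k)) i+1+k≡m
  1+i+j≡k : suc i + j ≡ k
  1+i+j≡k = trans (sym (+-suc i j)) (suc-injective 1+i+1+j≡1+k)
  i+2+j≡1+k : i + (2 + j) ≡ suc k
  i+2+j≡1+k = trans (+-suc i (suc j)) 1+i+1+j≡1+k

absorption : ∀ m k → suc k * (suc m C suc k) ≡ suc m * (m C k)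
absorption zero zero = refl
absorption zero (suc k) = begin
  suc (suc k) * (1 C suc (suc k)) ≡⟨ cong (suc (suc k) *_) (k>n⇒nCk≡0 (s≤s (s≤s (z≤n {k})))) ⟩
  suc (suc k) * 0                 ≡⟨ *-zeroʳ (suc (suc k)) ⟩
  0                               ≡⟨ sym (cong (1 *_) (k>n⇒nCk≡0 (s≤s (z≤n {k})))) ⟩
  1 * (0 C suc k)                 ∎
  where open ≡-Reasoning
absorption (suc m) zero = begin
  1 * (suc (suc m) C 1) ≡⟨ *-identityˡ (suc (suc m) C 1) ⟩
  suc (suc m) C 1       ≡⟨ nC1≡n (suc (suc m)) ⟩
  suc (suc m)           ≡⟨ sym (*-identityʳ (suc (suc m))) ⟩
  suc (suc m) * 1       ∎
  where open ≡-Reasoning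
absorption (suc m) (suc k) = begin
  suc (suc k) * (suc (suc m) C suc (suc k))
    ≡⟨ cong (suc (suc k) *_) (pascal (suc m) (suc k)) ⟩
  suc (suc k) * (suc m C suc k + suc m C suc (suc k))
    ≡⟨ *-distribˡ-+ (suc (suc k)) (suc m C suc k) _ ⟩
  (suc m C suc k + suc k * (suc m C suc k)) + suc (suc k) * (suc m C suc (suc k))
    ≡⟨ cong₂ (λ x y → (suc m C suc k + x) + y) (absorption m k) (absorption m (suc k)) ⟩
  (suc m C suc k + suc m * (m C k)) + suc m * (m C suc k)
    ≡⟨ +-assoc (suc m C suc k) _ _ ⟩
  suc m C suc k + (suc m * (m C k) + suc m * (m C suc k))
    ≡⟨ cong (suc m C suc k +_) (sym (*-distribˡ-+ (suc m) (m C k) (m C suc k))) ⟩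
  suc m C suc k + suc m * (m C k + m C suc k)
    ≡⟨ cong (λ x → suc m C suc k + suc m * x) (sym (pascal m k)) ⟩
  suc (suc m) * (suc m C suc k) ∎
  where open ≡-Reasoning

catalan≡ballot : ∀ n → catalan n ≡ ballot n 0
catalan≡ballot n = begin
  ((2 * n) C n) / suc n      ≡⟨ cong (λ m → (m C n) / suc n) (cong (n +_) (+-identityʳ n)) ⟩
  X / suc n                  ≡⟨ cong (_/ suc n) (sym (trans (*-comm (ballot n 0) (suc n)) [1+n]*ballot≡X)) ⟩
  ballot n 0 * suc n / suc n ≡⟨ m*n/n≡m (ballot n 0) (suc n) ⟩
  ballot n 0                 ∎
  where
  open ≡-Reasoning
  X Y : ℕ
  X = (n + n) C n
  Y = (n + n) C suc n
  ballot+Y≡X : ballot n 0 + Y ≡ X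
  ballot+Y≡X = ballot-binomial n 0 (n + n) n refl (+-identityʳ n)
  [1+n]*Y≡n*X : suc n * Y ≡ n * X
  [1+n]*Y≡n*X = +-cancelˡ-≡ (suc n * X) _ _ (begin
    suc n * X + suc n * Y   ≡⟨ sym (*-distribˡ-+ (suc n) X Y) ⟩
    suc n * (X + Y)         ≡⟨ cong (suc n *_) (sym (pascal (n + n) n)) ⟩
    suc n * (suc (n + n) C suc n) ≡⟨ absorption (n + n) n ⟩
    suc (n + n) * X         ≡⟨ cong (X +_) (*-distribʳ-+ X n n) ⟩
    X + (n * X + n * X)     ≡⟨ sym (+-assoc X (n * X) (n * X)) ⟩
    suc n * X + n * X       ∎)
  [1+n]*ballot≡X : suc n * ballot n 0 ≡ X
  [1+n]*ballot≡X = +-cancelʳ-≡ (n * X) _ _ (begin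
    suc n * ballot n 0 + n * X          ≡⟨ cong (suc n * ballot n 0 +_) (sym [1+n]*Y≡n*X) ⟩
    suc n * ballot n 0 + suc n * Y      ≡⟨ sym (*-distribˡ-+ (suc n) (ballot n 0) Y) ⟩
    suc n * (ballot n 0 + Y)            ≡⟨ cong (suc n *_) ballot+Y≡X ⟩
    X + n * X                           ∎)


module _ {A : Set} where

  ∈-delete : ∀ as {x y : A} {bs} → y ∈ as ++ x ∷ bs → y ≢ x → y ∈ as ++ bs
  ∈-delete []       (here y≡x) y≢x = ⊥-elim (y≢x y≡x)
  ∈-delete []       (there y∈) _   = y∈
  ∈-delete (a ∷ as) (here y≡a) _   = here y≡a
  ∈-delete (a ∷ as) (there y∈) y≢x = there (∈-delete as y∈ y≢x)

  unique⇒length≤ : ∀ {xs ys : List A} → Unique xs → (∀ {x} → x ∈ xs → x ∈ ys) → length xs ≤ length ys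
  unique⇒length≤ {[]}     _            _     = z≤n
  unique⇒length≤ {x ∷ xs} (x∉xs ∷ uxs) xs⊆ys with ∈-∃++ (xs⊆ys (here refl))
  ... | as , bs , refl = subst (suc (length xs) ≤_) (sym (length-++-sucʳ as x bs))
    (s≤s (unique⇒length≤ uxs λ y∈xs → ∈-delete as (xs⊆ys (there y∈xs)) (≢-sym (All.lookup x∉xs y∈xs))))

  unique-++⁻ˡ : ∀ (xs : List A) {ys} → Unique (xs ++ ys) → Unique xs
  unique-++⁻ˡ []       _           = []
  unique-++⁻ˡ (x ∷ xs) (x∉ ∷ uxs) = All-++⁻ˡ xs x∉ ∷ unique-++⁻ˡ xs uxs

  unique-++⁻ʳ : ∀ (xs : List A) {ys} → Unique (xs ++ ys) → Unique ys
  unique-++⁻ʳ []       u         = u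
  unique-++⁻ʳ (x ∷ xs) (_ ∷ uxs) = unique-++⁻ʳ xs uxs

  unique-++⇒∉ : ∀ (xs : List A) {ys v} → Unique (xs ++ ys) → v ∈ xs → v ∉ ys
  unique-++⇒∉ (x ∷ xs) (x∉ ∷ _)   (here refl) v∈ys = All¬⇒¬Any x∉ (∈-++⁺ʳ xs v∈ys)
  unique-++⇒∉ (x ∷ xs) (_ ∷ uxs) (there v∈xs) = unique-++⇒∉ xs uxs v∈xs

  infix-of-concat : ∀ {xs : List A} {xss} → xs ∈ xss → ∃₂ λ U V → concat xss ≡ U ++ xs ++ V
  infix-of-concat {xs = xs} xs∈xss with ∈-∃++ xs∈xss
  ... | as , bs , refl = concat as , concat bs , sym (concat-++ as (xs ∷ bs))

  length-infix : ∀ (U xs V : List A) → length xs ≤ length (U ++ xs ++ V)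
  length-infix U xs V = ≤-trans (length-++-≤ˡ xs) (length-++-≤ʳ (xs ++ V) {U})

  ⊆-snoc⁻ : ∀ (xs : List A) {x ys y} → xs ++ [ x ] ⊆ ys ++ [ y ] → xs ++ [ x ] ⊆ ys ⊎ (xs ⊆ ys × x ≡ y)
  ⊆-snoc⁻ [] {x} {ys} {y} [x]⊆ with ∈-++⁻ ys (to∈ [x]⊆)
  ... | inj₁ x∈ys        = inj₁ (from∈ x∈ys)
  ... | inj₂ (here x≡y)  = inj₂ (minimum ys , x≡y)
  ⊆-snoc⁻ (_ ∷ [])     {ys = []} (refl ∷ ())
  ⊆-snoc⁻ (_ ∷ _ ∷ _)  {ys = []} (refl ∷ ())
  ⊆-snoc⁻ (_ ∷ _)      {ys = []} (_ ∷ʳ ())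
  ⊆-snoc⁻ (w ∷ xs) {ys = z ∷ ys} (z ∷ʳ s) with ⊆-snoc⁻ (w ∷ xs) s
  ... | inj₁ s′          = inj₁ (z ∷ʳ s′)
  ... | inj₂ (s′ , x≡y)  = inj₂ (z ∷ʳ s′ , x≡y)
  ⊆-snoc⁻ (w ∷ xs) {ys = z ∷ ys} (w≡z ∷ s) with ⊆-snoc⁻ xs s
  ... | inj₁ s′          = inj₁ (w≡z ∷ s′)
  ... | inj₂ (s′ , x≡y)  = inj₂ (w≡z ∷ s′ , x≡y)

unique-map⁺ : ∀ {A B : Set} {f : A → B} {xs} → (∀ {x y} → x ∈ xs → y ∈ xs → f x ≡ f y → x ≡ y) →
              Unique xs → Unique (map f xs)
unique-map⁺ {xs = []}     _   []         = []
unique-map⁺ {xs = x ∷ xs} inj (x∉ ∷ uxs) =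
  All-map⁺ (All.tabulate λ y∈ fx≡fy → All.lookup x∉ y∈ (inj (here refl) (there y∈) fx≡fy))
  ∷ unique-map⁺ (λ x∈ y∈ → inj (there x∈) (there y∈)) uxs

missing⇒length< : ∀ {k r xs} → Unique xs → All (_< k) xs → r < k → r ∉ xs → length xs < k
missing⇒length< {k} {r} {xs} uxs xs<k r<k r∉xs =
  subst (length (r ∷ xs) ≤_) (length-upTo k) (unique⇒length≤ (¬Any⇒All¬ xs r∉xs ∷ uxs) r∷xs⊆upTo)
  where
  r∷xs⊆upTo : ∀ {x} → x ∈ r ∷ xs → x ∈ upTo k
  r∷xs⊆upTo (here refl) = ∈-upTo⁺ r<k
  r∷xs⊆upTo (there x∈xs) = ∈-upTo⁺ (All.lookup xs<k x∈xs)

covering⇒≤length : ∀ {k xs} → (∀ {r} → r < k → r ∈ xs) → k ≤ length xs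
covering⇒≤length {k} covers = subst (_≤ _) (length-upTo k) (unique⇒length≤ (upTo⁺ k) (covers ∘ ∈-upTo⁻))

record IsPermutation (n : ℕ) (w : List ℕ) : Set where
  field
    unique  : Unique w
    bounded : All (_< n) w
    length≡ : length w ≡ n

permutation-∋ : ∀ {n w r} → IsPermutation n w → r < n → r ∈ w
permutation-∋ {w = w} {r} perm r<n with r ∈? w
... | yes r∈w = r∈w
... | no  r∉w = ⊥-elim (<-irrefl length≡ (missing⇒length< unique bounded r<n r∉w))
  where open IsPermutation perm

Ascending : List ℕ → Set
Ascending = AllPairs _<_

upTo-ascending : ∀ n → Ascending (upTo n)
upTo-ascending n = AllPairs.applyUpTo⁺₁ (λ i → i) n (λ i<j _ → i<j)

ascending-⊆ : ∀ {xs ys} → xs ⊆ ys → Ascending ys → Ascending xs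
ascending-⊆ []         _            = []
ascending-⊆ (y ∷ʳ xs⊆) (_ ∷ ys↑)    = ascending-⊆ xs⊆ ys↑
ascending-⊆ (refl ∷ xs⊆) (y< ∷ ys↑) = All-resp-⊆ xs⊆ y< ∷ ascending-⊆ xs⊆ ys↑

∈-∷⇒head≤ : ∀ {u us z} → All (u <_) us → z ∈ u ∷ us → u ≤ z
∈-∷⇒head≤ _  (here refl) = ≤-refl
∈-∷⇒head≤ u< (there z∈)  = <⇒≤ (All.lookup u< z∈)

∈-∷⇒∈-tail : ∀ {u us z} → z ∈ u ∷ us → u < z → z ∈ us
∈-∷⇒∈-tail (here refl) u<u = ⊥-elim (<-irrefl refl u<u)
∈-∷⇒∈-tail (there z∈)  _   = z∈

ascending-≡ : ∀ {xs ys} → Ascending xs → Ascending ys →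
              (∀ {z} → z ∈ xs → z ∈ ys) → (∀ {z} → z ∈ ys → z ∈ xs) → xs ≡ ys
ascending-≡ {[]}     {[]}     _ _ _ _ = refl
ascending-≡ {[]}     {y ∷ ys} _ _ _ ys⊆ with () ← ys⊆ (here refl)
ascending-≡ {x ∷ xs} {[]}     _ _ xs⊆ _ with () ← xs⊆ (here refl)
ascending-≡ {x ∷ xs} {y ∷ ys} (x< ∷ xs↑) (y< ∷ ys↑) xs⊆ ys⊆
  with refl ← ≤-antisym (∈-∷⇒head≤ x< (ys⊆ (here refl))) (∈-∷⇒head≤ y< (xs⊆ (here refl)))
  = cong (x ∷_) (ascending-≡ xs↑ ys↑ (λ z∈ → ∈-∷⇒∈-tail (xs⊆ (there z∈)) (All.lookup x< z∈))
                                     (λ z∈ → ∈-∷⇒∈-tail (ys⊆ (there z∈)) (All.lookup y< z∈)))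

ascending⇒⊆upTo : ∀ {n xs} → Ascending xs → All (_< n) xs → xs ⊆ upTo n
ascending⇒⊆upTo {n} {xs} xs↑ xs<n = subst (_⊆ upTo n) filter≡xs (filter-⊆ (_∈? xs) (upTo n))
  where
  filter≡xs : filter (_∈? xs) (upTo n) ≡ xs
  filter≡xs = ascending-≡ (AllPairs.filter⁺ (_∈? xs) (upTo-ascending n)) xs↑
    (proj₂ ∘ ∈-filter⁻ (_∈? xs) {xs = upTo n}) (λ z∈ → ∈-filter⁺ (_∈? xs) (∈-upTo⁺ (All.lookup xs<n z∈)) z∈)

data Adjacent {A : Set} (u v : A) : List A → Set where
  here  : ∀ {xs} → Adjacent u v (u ∷ v ∷ xs)
  there : ∀ {x xs} → Adjacent u v xs → Adjacent u v (x ∷ xs)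

module _ {A : Set} {u v : A} where

  adjacent-++⁺ˡ : ∀ {xs} ys → Adjacent u v xs → Adjacent u v (xs ++ ys)
  adjacent-++⁺ˡ ys here        = here
  adjacent-++⁺ˡ ys (there adj) = there (adjacent-++⁺ˡ ys adj)

  adjacent-++⁺ʳ : ∀ xs {ys} → Adjacent u v ys → Adjacent u v (xs ++ ys)
  adjacent-++⁺ʳ []       adj = adj
  adjacent-++⁺ʳ (x ∷ xs) adj = there (adjacent-++⁺ʳ xs adj)

  adjacent-++⁻ : ∀ xs {ys} → Adjacent u v (xs ++ ys) →
                 Adjacent u v xs ⊎ (u ∈ xs × ∃[ ys′ ] ys ≡ v ∷ ys′) ⊎ Adjacent u v ys
  adjacent-++⁻ []            adj         = inj₂ (inj₂ adj)
  adjacent-++⁻ (x ∷ [])      here        = inj₂ (inj₁ (here refl , _ , refl))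
  adjacent-++⁻ (x ∷ [])      (there adj) = inj₂ (inj₂ adj)
  adjacent-++⁻ (x ∷ y ∷ xs)  here        = inj₁ here
  adjacent-++⁻ (x ∷ y ∷ xs)  (there adj) with adjacent-++⁻ (y ∷ xs) adj
  ... | inj₁ adj′               = inj₁ (there adj′)
  ... | inj₂ (inj₁ (u∈ , eq))   = inj₂ (inj₁ (there u∈ , eq))
  ... | inj₂ (inj₂ adj′)        = inj₂ (inj₂ adj′)

  adjacent⇒∈ˡ : ∀ {xs} → Adjacent u v xs → u ∈ xs
  adjacent⇒∈ˡ here        = here refl
  adjacent⇒∈ˡ (there adj) = there (adjacent⇒∈ˡ adj)

  adjacent⇒∈ʳ : ∀ {xs} → Adjacent u v xs → v ∈ xs
  adjacent⇒∈ʳ here        = there (here refl)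
  adjacent⇒∈ʳ (there adj) = there (adjacent⇒∈ʳ adj)

  adjacent-⊆ : ∀ {xs w} → Adjacent u v xs → Unique xs → v ∷ w ∷ [] ⊆ xs → u ∷ v ∷ w ∷ [] ⊆ xs
  adjacent-⊆ here ((u≢u ∷ _) ∷ _) (refl ∷ _)      = ⊥-elim (u≢u refl)
  adjacent-⊆ here (_ ∷ v∉ ∷ _)    (_ ∷ʳ _ ∷ʳ vw⊆) = ⊥-elim (All¬⇒¬Any v∉ (to∈ vw⊆))
  adjacent-⊆ here _               (_ ∷ʳ refl ∷ w⊆) = refl ∷ refl ∷ w⊆
  adjacent-⊆ (there adj) (_ ∷ uxs) (_ ∷ʳ vw⊆)     = _ ∷ʳ adjacent-⊆ adj uxs vw⊆
  adjacent-⊆ (there adj) (v∉ ∷ _) (refl ∷ _)      = ⊥-elim (All¬⇒¬Any v∉ (adjacent⇒∈ʳ adj))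

links : List ℕ → ℕ → List (ℕ × ℕ)
links []           z = []
links (u ∷ [])     z = (u , z) ∷ []
links (u ∷ v ∷ us) z = (u , v) ∷ links (v ∷ us) z

keys-links : ∀ us z → map proj₁ (links us z) ≡ us
keys-links []           z = refl
keys-links (u ∷ [])     z = refl
keys-links (u ∷ v ∷ us) z = cong (u ∷_) (keys-links (v ∷ us) z)

values-links : ∀ u us z → map proj₂ (links (u ∷ us) z) ≡ us ++ [ z ]
values-links u []       z = refl
values-links u (v ∷ us) z = cong (v ∷_) (values-links v us z)

adjacent⇒∈links : ∀ {u v us} z → Adjacent u v us → (u , v) ∈ links us z
adjacent⇒∈links z (here {[]})     = here refl
adjacent⇒∈links z (here {_ ∷ _})  = here refl
adjacent⇒∈links z (there {_} {_ ∷ _} adj) = there (adjacent⇒∈links z adj)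

module _ {A : Set} {P : Pred A 0ℓ} (P? : Decidable P) where

  filter-cong-local : ∀ {Q : Pred A 0ℓ} (Q? : Decidable Q) → ∀ {xs} → (∀ {x} → x ∈ xs → P x ⇔ Q x) →
                      filter P? xs ≡ filter Q? xs
  filter-cong-local Q? {[]}     _   = refl
  filter-cong-local Q? {x ∷ xs} P⇔Q with P? x | Q? x
  ... | yes _   | yes _   = cong (x ∷_) (filter-cong-local Q? (P⇔Q ∘ there))
  ... | no  _   | no  _   = filter-cong-local Q? (P⇔Q ∘ there)
  ... | yes px  | no  ¬qx = ⊥-elim (¬qx (Equivalence.to (P⇔Q (here refl)) px))
  ... | no  ¬px | yes qx  = ⊥-elim (¬px (Equivalence.from (P⇔Q (here refl)) qx))

  filter-filter : ∀ {Q : Pred A 0ℓ} (Q? : Decidable Q) → ∀ xs → filter P? (filter Q? xs) ≡ filter (Q? ∩? P?) xs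
  filter-filter Q? []       = refl
  filter-filter Q? (x ∷ xs) with Q? x
  ... | no  _ = filter-filter Q? xs
  ... | yes _ with P? x
  ...   | yes _ = cong (x ∷_) (filter-filter Q? xs)
  ...   | no  _ = filter-filter Q? xs

  length-filter-map : ∀ {B : Set} (f : B → A) xs → length (filter P? (map f xs)) ≡ length (filter (P? ∘ f) xs)
  length-filter-map f []       = refl
  length-filter-map f (x ∷ xs) with does (P? (f x))
  ... | true  = cong suc (length-filter-map f xs)
  ... | false = length-filter-map f xs

  length-filter-concatMap : ∀ (g : ℕ → List A) f n →
    length (filter P? (concatMap g (applyUpTo f n))) ≡ ∑< n (λ t → length (filter P? (g (f t))))
  length-filter-concatMap g f zero    = refl
  length-filter-concatMap g f (suc n) = begin
    length (filter P? (g (f 0) ++ concatMap g (applyUpTo (f ∘ suc) n)))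
      ≡⟨ cong length (filter-++ P? (g (f 0)) _) ⟩
    length (filter P? (g (f 0)) ++ filter P? (concatMap g (applyUpTo (f ∘ suc) n)))
      ≡⟨ length-++ (filter P? (g (f 0))) ⟩
    length (filter P? (g (f 0))) + length (filter P? (concatMap g (applyUpTo (f ∘ suc) n)))
      ≡⟨ cong (length (filter P? (g (f 0))) +_) (length-filter-concatMap g (f ∘ suc) n) ⟩
    ∑< (suc n) (λ t → length (filter P? (g (f t)))) ∎
    where open ≡-Reasoning


∈-choose⁻ : ∀ k L {X} → X ∈ choose k L → X ⊆ L × length X ≡ k
∈-choose⁻ zero    L        (here refl) = minimum L , refl
∈-choose⁻ (suc k) (x ∷ L)  X∈ with ∈-++⁻ (map (x ∷_) (choose k L)) X∈
... | inj₁ X∈map with ∈-map⁻ (x ∷_) X∈map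
...   | Y , Y∈ , refl = let Y⊆L , len = ∈-choose⁻ k L Y∈ in refl ∷ Y⊆L , cong suc len
∈-choose⁻ (suc k) (x ∷ L)  X∈ | inj₂ X∈rest =
  let X⊆L , len = ∈-choose⁻ (suc k) L X∈rest in x ∷ʳ X⊆L , len

∈-choose⁺ : ∀ {X L} → X ⊆ L → X ∈ choose (length X) L
∈-choose⁺ {[]} {[]}    [] = here refl
∈-choose⁺ {[]} {_ ∷ _} _  = here refl
∈-choose⁺ {x ∷ X} (y ∷ʳ X⊆L) = ∈-++⁺ʳ (map (y ∷_) (choose (length X) _)) (∈-choose⁺ X⊆L)
∈-choose⁺ {x ∷ X} (refl ∷ X⊆L) = ∈-++⁺ˡ (∈-map⁺ (x ∷_) (∈-choose⁺ X⊆L))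

isSubseqᵇ⇒⊆ : ∀ ws ps → T (isSubseqᵇ ws ps) → ws ⊆ ps
isSubseqᵇ⇒⊆ []       ps       _ = minimum ps
isSubseqᵇ⇒⊆ (w ∷ ws) (p ∷ ps) h with w ≡ᵇ p | ≡ᵇ⇒≡ w p
... | true  | w≡p = w≡p _ ∷ isSubseqᵇ⇒⊆ ws ps h
... | false | _   = p ∷ʳ isSubseqᵇ⇒⊆ (w ∷ ws) ps h

⊆⇒isSubseqᵇ : ∀ {ws ps} → ws ⊆ ps → T (isSubseqᵇ ws ps)
⊆⇒isSubseqᵇ {[]} _                = _
⊆⇒isSubseqᵇ {w ∷ ws} {p ∷ ps} ws⊆ with w ≡ᵇ p | ≡⇒≡ᵇ w p
⊆⇒isSubseqᵇ (p ∷ʳ ws⊆)   | true  | _   = ⊆⇒isSubseqᵇ (∷ˡ⁻ ws⊆)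
⊆⇒isSubseqᵇ (refl ∷ ws⊆) | true  | _   = ⊆⇒isSubseqᵇ ws⊆
⊆⇒isSubseqᵇ (p ∷ʳ ws⊆)   | false | _   = ⊆⇒isSubseqᵇ ws⊆
⊆⇒isSubseqᵇ (refl ∷ ws⊆) | false | w≢w = ⊥-elim (w≢w refl)

elemᵇ⇒∈ : ∀ {x xs} → T (elemᵇ x xs) → x ∈ xs
elemᵇ⇒∈ {x} {xs} h = Any.map (≡ᵇ⇒≡ x _) (any⁻ (x ≡ᵇ_) xs h)

∈⇒elemᵇ : ∀ {x xs} → x ∈ xs → T (elemᵇ x xs)
∈⇒elemᵇ {x} x∈xs = any⁺ (x ≡ᵇ_) (Any.map (≡⇒≡ᵇ x _) x∈xs)

distinctᵇ⇒unique : ∀ xs → T (distinctᵇ xs) → Unique xs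
distinctᵇ⇒unique []       _ = []
distinctᵇ⇒unique (x ∷ xs) h with elemᵇ x xs | ∈⇒elemᵇ {x} {xs}
... | false | x∉xs = ¬Any⇒All¬ xs x∉xs ∷ distinctᵇ⇒unique xs h

unique⇒distinctᵇ : ∀ {xs} → Unique xs → T (distinctᵇ xs)
unique⇒distinctᵇ []                  = _
unique⇒distinctᵇ {x ∷ xs} (x∉xs ∷ u) with elemᵇ x xs | elemᵇ⇒∈ {x} {xs}
... | false | _    = unique⇒distinctᵇ u
... | true  | x∈xs = ⊥-elim (All¬⇒¬Any x∉xs (x∈xs _))

∈-allLists⁻ : ∀ n l {w} → w ∈ allLists n l → length w ≡ l × All (_< n) w
∈-allLists⁻ n zero    (here refl) = refl , []
∈-allLists⁻ n (suc l) w∈ with find (∈-concatMap⁻ (λ x → map (x ∷_) (allLists n l)) {xs = upTo n} w∈)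
... | x , x∈ , w∈map with ∈-map⁻ (x ∷_) w∈map
...   | v , v∈ , refl = let len , v<n = ∈-allLists⁻ n l v∈ in cong suc len , ∈-upTo⁻ x∈ ∷ v<n

∈-allLists⁺ : ∀ n {w} → All (_< n) w → w ∈ allLists n (length w)
∈-allLists⁺ n []             = here refl
∈-allLists⁺ n {x ∷ w} (x<n ∷ w<n) =
  ∈-concatMap⁺ (λ y → map (y ∷_) (allLists n (length w))) (lose (∈-upTo⁺ x<n) (∈-map⁺ (x ∷_) (∈-allLists⁺ n w<n)))

∈-perms⁻ : ∀ {n w} → w ∈ perms n → IsPermutation n w
∈-perms⁻ {n} w∈ with ∈-filter⁻ (T? ∘ distinctᵇ) {xs = allLists n n} w∈
... | w∈all , dist = let len , w<n = ∈-allLists⁻ n n w∈all in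
  record { unique = distinctᵇ⇒unique _ dist ; bounded = w<n ; length≡ = len }

∈-perms⁺ : ∀ {n w} → IsPermutation n w → w ∈ perms n
∈-perms⁺ {n} perm =
  ∈-filter⁺ (T? ∘ distinctᵇ) (subst (λ l → _ ∈ allLists n l) length≡ (∈-allLists⁺ n bounded)) (unique⇒distinctᵇ unique)
  where open IsPermutation perm

at-map-applyUpTo : ∀ (g f : ℕ → ℕ) n {v} → v < n → at (map g (applyUpTo f n)) v ≡ g (f v)
at-map-applyUpTo g f (suc n) {zero}  _         = refl
at-map-applyUpTo g f (suc n) {suc v} (s≤s v<n) = at-map-applyUpTo g (f ∘ suc) n v<n


-- Counting 312-avoiding permutations

record Contains312 (w : List ℕ) : Set where
  constructor contains312
  field
    {x₁ x₂ x₃} : ℕ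
    x₁<x₂      : x₁ < x₂
    x₂<x₃      : x₂ < x₃
    occurs     : x₃ ∷ x₁ ∷ x₂ ∷ [] ⊆ w

Is312 : List ℕ → Set
Is312 (x₃ ∷ x₁ ∷ x₂ ∷ []) = x₁ < x₂ × x₂ < x₃
Is312 _                   = ⊥

is312? : Decidable Is312
is312? []                  = no λ ()
is312? (_ ∷ [])            = no λ ()
is312? (_ ∷ _ ∷ [])        = no λ ()
is312? (x₃ ∷ x₁ ∷ x₂ ∷ []) = (x₁ <? x₂) ×-dec (x₂ <? x₃)
is312? (_ ∷ _ ∷ _ ∷ _ ∷ _) = no λ ()

contains312? : Decidable Contains312
contains312? w = map′ (from-choose ∘ find) (λ (contains312 x₁<x₂ x₂<x₃ occurs) → lose (∈-choose⁺ occurs) (x₁<x₂ , x₂<x₃))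
                      (Any.any? is312? (choose 3 w))
  where
  from-choose : (∃[ X ] X ∈ choose 3 w × Is312 X) → Contains312 w
  from-choose (_ ∷ _ ∷ _ ∷ [] , X∈ , x₁<x₂ , x₂<x₃) = contains312 x₁<x₂ x₂<x₃ (proj₁ (∈-choose⁻ 3 w X∈))

Avoider : List ℕ → Set
Avoider w = Unique w × ¬ Contains312 w

avoider? : Decidable Avoider
avoider? w = unique? w ×-dec ¬? (contains312? w)

strictSup : List ℕ → ℕ
strictSup = foldr (λ x m → suc x ⊔ m) 0

∈⇒<strictSup : ∀ {p x} → x ∈ p → x < strictSup p
∈⇒<strictSup {y ∷ p} (here refl) = m≤m⊔n (suc y) (strictSup p)
∈⇒<strictSup {y ∷ p} (there x∈p) = ≤-trans (∈⇒<strictSup x∈p) (m≤n⊔m (suc y) (strictSup p))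

<strictSup⇒≤∈ : ∀ p {y} → y < strictSup p → ∃[ x ] x ∈ p × y ≤ x
<strictSup⇒≤∈ (x ∷ p) {y} y< with ≤-total (suc x) (strictSup p)
... | inj₁ 1+x≤sup = let z , z∈p , y≤z = <strictSup⇒≤∈ p (subst (y <_) (m≤n⇒m⊔n≡n 1+x≤sup) y<) in z , there z∈p , y≤z
... | inj₂ sup≤1+x = x , here refl , s≤s⁻¹ (subst (y <_) (m≥n⇒m⊔n≡m sup≤1+x) y<)

strictSup-snoc : ∀ p y → strictSup (p ++ [ y ]) ≡ strictSup p ⊔ suc y
strictSup-snoc []      y = ⊔-identityʳ (suc y)
strictSup-snoc (x ∷ p) y = trans (cong (suc x ⊔_) (strictSup-snoc p y)) (sym (⊔-assoc (suc x) (strictSup p) (suc y)))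

record LargestGap (p : List ℕ) (T : ℕ) : Set where
  field
    gap       : ℕ
    gap<T     : gap < T
    gap∉p     : gap ∉ p
    above-gap : ∀ {r} → gap < r → r < T → r ∈ p

largestGap : ∀ p T → (∀ {x} → x < T → x ∈ p) ⊎ LargestGap p T
largestGap p zero = inj₁ λ ()
largestGap p (suc T) with T ∈? p
... | no T∉p = inj₂ record
  { gap = T ; gap<T = n<1+n T ; gap∉p = T∉p
  ; above-gap = λ T<r r<1+T → ⊥-elim (<-irrefl refl (<-≤-trans T<r (s≤s⁻¹ r<1+T))) }
... | yes T∈p with largestGap p T
...   | inj₁ below-T = inj₁ λ x<1+T → [ below-T , (λ x≡T → subst (_∈ p) (sym x≡T) T∈p) ]′ (m≤n⇒m<n∨m≡n (s≤s⁻¹ x<1+T))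
...   | inj₂ g = inj₂ record
  { gap = gap ; gap<T = m<n⇒m<1+n gap<T ; gap∉p = gap∉p
  ; above-gap = λ gap<r r<1+T → [ above-gap gap<r , (λ r≡T → subst (_∈ p) (sym r≡T) T∈p) ]′ (m≤n⇒m<n∨m≡n (s≤s⁻¹ r<1+T)) }
  where open LargestGap g

prefix+rest≡ : ∀ {L j T i n l} → L + j ≡ T → T + i ≡ n → i + j ≡ l → L + l ≡ n
prefix+rest≡ {L} {j} {i = i} refl refl refl = lemma L j i
  where
  lemma : ∀ L j i → L + (i + j) ≡ L + j + i
  lemma = solve-∀

new-max-sup : ∀ {T t d i n} → suc t + d ≡ i → T + i ≡ n → suc (T + t) + d ≡ n
new-max-sup {T} {t} {d} refl refl = lemma T t d
  where
  lemma : ∀ T t d → suc (T + t) + d ≡ T + (suc t + d)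
  lemma = solve-∀

new-max-length : ∀ {L j T t} → L + j ≡ T → (L + 1) + (j + t) ≡ suc (T + t)
new-max-length {L} {j} {t = t} refl = lemma L j t
  where
  lemma : ∀ L j t → (L + 1) + (j + t) ≡ suc (L + j + t)
  lemma = solve-∀

new-max-rest : ∀ {t d i j l} → suc t + d ≡ i → i + j ≡ suc l → d + (j + t) ≡ l
new-max-rest {t} {d} {j = j} refl i+j≡1+l = suc-injective (trans (lemma t d j) i+j≡1+l)
  where
  lemma : ∀ t d j → suc (d + (j + t)) ≡ suc t + d + j
  lemma = solve-∀

module Completions (n : ℕ) where

  completions : List ℕ → ℕ → ℕ
  completions p l = length (filter (avoider? ∘ (p ++_)) (allLists n l))

  record Viable (p : List ℕ) : Set where
    field
      unique    : Unique p
      bounded   : All (_< n) p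
      avoids    : ¬ Contains312 p
      -- r placed after x₃ x₁ would complete a 312
      untrapped : ∀ {x₃ x₁ r} → x₃ ∷ x₁ ∷ [] ⊆ p → x₁ < r → r < x₃ → r ∈ p

  viable-snoc : ∀ {p y} → Viable p → y < n → y ∉ p →
                (∀ {x₃ r} → x₃ ∈ p → y < r → r < x₃ → r ∈ p) → Viable (p ++ [ y ])
  viable-snoc {p} {y} V y<n y∉p y-untrapped = record
    { unique    = Unique-++⁺ unique ([] ∷ []) (λ { (y∈p , here refl) → y∉p y∈p })
    ; bounded   = All-++⁺ bounded (y<n ∷ [])
    ; avoids    = avoids′
    ; untrapped = untrapped′
    }
    where
    open Viable V
    avoids′ : ¬ Contains312 (p ++ [ y ])
    avoids′ (contains312 x₁<x₂ x₂<x₃ occ) with ⊆-snoc⁻ (_ ∷ _ ∷ []) occ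
    ... | inj₁ occ′           = avoids (contains312 x₁<x₂ x₂<x₃ occ′)
    ... | inj₂ (pair⊆ , refl) = y∉p (untrapped pair⊆ x₁<x₂ x₂<x₃)
    untrapped′ : ∀ {x₃ x₁ r} → x₃ ∷ x₁ ∷ [] ⊆ p ++ [ y ] → x₁ < r → r < x₃ → r ∈ p ++ [ y ]
    untrapped′ pair⊆ x₁<r r<x₃ with ⊆-snoc⁻ (_ ∷ []) pair⊆
    ... | inj₁ pair⊆p       = ∈-++⁺ˡ (untrapped pair⊆p x₁<r r<x₃)
    ... | inj₂ (x₃⊆ , refl) = ∈-++⁺ˡ (y-untrapped (to∈ x₃⊆) x₁<r r<x₃)

  completions-done : ∀ {p} → Viable p → completions p 0 ≡ 1
  completions-done {p} V =
    cong length (filter-accept (avoider? ∘ (p ++_)) (subst Avoider (sym (++-identityʳ p)) (unique , avoids)))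
    where open Viable V

  completions-step : ∀ p l → completions p (suc l) ≡ ∑< n (λ x → completions (p ++ [ x ]) l)
  completions-step p l = begin
    completions p (suc l)
      ≡⟨ length-filter-concatMap (avoider? ∘ (p ++_)) (λ x → map (x ∷_) (allLists n l)) (λ x → x) n ⟩
    ∑< n (λ x → length (filter (avoider? ∘ (p ++_)) (map (x ∷_) (allLists n l))))
      ≡⟨ ∑<-cong n (λ {x} _ → trans (length-filter-map (avoider? ∘ (p ++_)) (x ∷_) (allLists n l))
                                    (cong length (reassociate x))) ⟩
    ∑< n (λ x → completions (p ++ [ x ]) l) ∎
    where
    open ≡-Reasoning
    reassociate : ∀ x → filter (avoider? ∘ (p ++_) ∘ (x ∷_)) (allLists n l)
                      ≡ filter (avoider? ∘ ((p ++ [ x ]) ++_)) (allLists n l)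
    reassociate x = filter-cong-local (avoider? ∘ (p ++_) ∘ (x ∷_)) (avoider? ∘ ((p ++ [ x ]) ++_)) {xs = allLists n l}
      λ {w} _ →
        let assoc = ++-assoc p [ x ] w in mk⇔ (subst Avoider (sym assoc)) (subst Avoider assoc)

  completions-split : ∀ p l i → strictSup p + i ≡ n →
    completions p (suc l) ≡ ∑< (strictSup p) (λ x → completions (p ++ [ x ]) l)
                          + ∑< i (λ t → completions (p ++ [ strictSup p + t ]) l)
  completions-split p l i sup+i≡n = trans (completions-step p l)
    (trans (cong (λ m → ∑< m (λ x → completions (p ++ [ x ]) l)) (sym sup+i≡n)) (∑<-+ (strictSup p) i _))

  completions-repeat : ∀ {q} l → ¬ Unique q → completions q l ≡ 0
  completions-repeat {q} l ¬uq = cong length (filter-none (avoider? ∘ (q ++_)) {xs = allLists n l}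
    (All.tabulate λ {w} _ (uqw , _) → ¬uq (unique-++⁻ˡ q uqw)))

  completions-trapped : ∀ {q x₃ x₁ r} l → All (_< n) q → length q + l ≡ n →
    x₃ ∷ x₁ ∷ [] ⊆ q → x₁ < r → r < x₃ → r ∉ q → completions q l ≡ 0
  completions-trapped {q} {x₃} {x₁} {r} l q<n len≡n pair⊆ x₁<r r<x₃ r∉q =
    cong length (filter-none (avoider? ∘ (q ++_)) {xs = allLists n l} (All.tabulate no-completion))
    where
    r<n : r < n
    r<n = <-trans r<x₃ (All.lookup q<n (to∈ pair⊆))
    r∈completion : ∀ {w} → IsPermutation n (q ++ w) → r ∈ w
    r∈completion perm with ∈-++⁻ q (permutation-∋ perm r<n)
    ... | inj₁ r∈q = ⊥-elim (r∉q r∈q)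
    ... | inj₂ r∈w = r∈w
    no-completion : ∀ {w} → w ∈ allLists n l → ¬ Avoider (q ++ w)
    no-completion {w} w∈ (uqw , avoids) with ∈-allLists⁻ n l w∈
    ... | len , w<n = avoids (contains312 x₁<r r<x₃ (++⁺ pair⊆ (from∈ (r∈completion record
      { unique = uqw ; bounded = All-++⁺ q<n w<n ; length≡ = trans (length-++ q) (trans (cong (length q +_) len) len≡n) }))))

  completions-below-complete : ∀ {p} l → (∀ {x} → x < strictSup p → x ∈ p) →
    ∑< (strictSup p) (λ x → completions (p ++ [ x ]) l) ≡ 0
  completions-below-complete {p} l complete =
    ∑<-zero (strictSup p) λ x<sup → completions-repeat l λ u → unique-++⇒∉ p u (complete x<sup) (here refl)

  completions-below-gap : ∀ {p} l → Viable p → length p + suc l ≡ n → (g : LargestGap p (strictSup p)) →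
    ∑< (strictSup p) (λ x → completions (p ++ [ x ]) l) ≡ completions (p ++ [ LargestGap.gap g ]) l
  completions-below-gap {p} l V len≡n g = ∑<-single (strictSup p) gap<T others
    where
    open Viable V
    open LargestGap g
    others : ∀ {x} → x < strictSup p → x ≢ gap → completions (p ++ [ x ]) l ≡ 0
    others {x} x<sup x≢gap with x ∈? p
    ... | yes x∈p = completions-repeat l λ u → unique-++⇒∉ p u x∈p (here refl)
    ... | no  x∉p with <-cmp x gap
    ...   | tri> _ _ gap<x = ⊥-elim (x∉p (above-gap gap<x x<sup))
    ...   | tri≈ _ x≡gap _ = ⊥-elim (x≢gap x≡gap)
    ...   | tri< x<gap _ _ with <strictSup⇒≤∈ p gap<T
    ...     | c , c∈p , gap≤c =
      completions-trapped l (All-++⁺ bounded (<-trans x<c c<n ∷ [])) len′≡n (++⁺ (from∈ c∈p) ⊆-refl) x<gap gap<c gap∉p++[x]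
      where
      gap<c : gap < c
      gap<c = ≤∧≢⇒< gap≤c λ gap≡c → gap∉p (subst (_∈ p) (sym gap≡c) c∈p)
      x<c : x < c
      x<c = <-trans x<gap gap<c
      c<n : c < n
      c<n = All.lookup bounded c∈p
      len′≡n : length (p ++ [ x ]) + l ≡ n
      len′≡n = trans (cong (_+ l) (length-++ p)) (trans (+-assoc (length p) 1 l) len≡n)
      gap∉p++[x] : gap ∉ p ++ [ x ]
      gap∉p++[x] gap∈ with ∈-++⁻ p gap∈
      ... | inj₁ gap∈p        = gap∉p gap∈p
      ... | inj₂ (here gap≡x) = x≢gap (sym gap≡x)

  viable-new-max : ∀ {p x} → Viable p → strictSup p ≤ x → x < n → Viable (p ++ [ x ])
  viable-new-max V sup≤x x<n = viable-snoc V x<n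
    (λ x∈p → <⇒≱ (∈⇒<strictSup x∈p) sup≤x)
    (λ x₃∈p x<r r<x₃ → ⊥-elim (<-asym (<-trans (∈⇒<strictSup x₃∈p) (≤-<-trans sup≤x x<r)) r<x₃))

  viable-gap : ∀ {p} → Viable p → strictSup p ≤ n → (g : LargestGap p (strictSup p)) → Viable (p ++ [ LargestGap.gap g ])
  viable-gap V sup≤n g = viable-snoc V (<-≤-trans gap<T sup≤n) gap∉p
    λ x₃∈p gap<r r<x₃ → above-gap gap<r (<-trans r<x₃ (∈⇒<strictSup x₃∈p))
    where open LargestGap g

  gap-snoc-shape : ∀ {p i j} (g : LargestGap p (strictSup p)) → let q = p ++ [ LargestGap.gap g ] in
    strictSup p + i ≡ n → length p + suc j ≡ strictSup p → strictSup q + i ≡ n × length q + j ≡ strictSup q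
  gap-snoc-shape {p} {i} {j} g sup+i≡n len+1+j≡sup =
    trans (cong (_+ i) sup′≡sup) sup+i≡n ,
    trans (cong (_+ j) (length-++ p)) (trans (+-assoc (length p) 1 j) (trans len+1+j≡sup (sym sup′≡sup)))
    where
    open LargestGap g
    sup′≡sup : strictSup (p ++ [ gap ]) ≡ strictSup p
    sup′≡sup = trans (strictSup-snoc p gap) (m≥n⇒m⊔n≡m gap<T)

  mutual
    completions≡ballot : ∀ l {p} i j → Viable p → strictSup p + i ≡ n → length p + j ≡ strictSup p → i + j ≡ l →
                         completions p l ≡ ballot i j
    completions≡ballot zero    zero    zero    V _ _ _ = completions-done V
    completions≡ballot (suc l) {p} (suc i) zero V sup+i≡n len+0≡sup i+0≡1+l = begin
      completions p (suc l)
        ≡⟨ completions-split p l (suc i) sup+i≡n ⟩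
      ∑< (strictSup p) (λ x → completions (p ++ [ x ]) l) + ∑< (suc i) (λ t → completions (p ++ [ strictSup p + t ]) l)
        ≡⟨ cong₂ _+_ (completions-below-complete l complete)
                     (completions-new-max l (suc i) zero V sup+i≡n len+0≡sup i+0≡1+l) ⟩
      newMaxSum (suc i) 0
        ≡⟨ newMaxSum-suc i 0 ⟩
      ballot (suc i) 0 ∎
      where
      open ≡-Reasoning
      complete : ∀ {x} → x < strictSup p → x ∈ p
      complete with largestGap p (strictSup p)
      ... | inj₁ below-sup = below-sup
      ... | inj₂ g = ⊥-elim (<-irrefl (trans (sym (+-identityʳ (length p))) len+0≡sup)
                                        (missing⇒length< (Viable.unique V) (All.tabulate ∈⇒<strictSup) gap<T gap∉p))
        where open LargestGap g
    completions≡ballot (suc l) {p} i (suc j) V sup+i≡n len+j≡sup i+j≡1+l with largestGap p (strictSup p)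
    ... | inj₁ complete =
      ⊥-elim (<⇒≱ (subst (length p <_) len+j≡sup (m<m+n (length p) (s≤s z≤n))) (covering⇒≤length complete))
    ... | inj₂ g = begin
      completions p (suc l)
        ≡⟨ completions-split p l i sup+i≡n ⟩
      ∑< (strictSup p) (λ x → completions (p ++ [ x ]) l) + ∑< i (λ t → completions (p ++ [ strictSup p + t ]) l)
        ≡⟨ cong₂ _+_ (completions-below-gap l V (prefix+rest≡ len+j≡sup sup+i≡n i+j≡1+l) g)
                     (completions-new-max l i (suc j) V sup+i≡n len+j≡sup i+j≡1+l) ⟩
      completions (p ++ [ gap ]) l + newMaxSum i (suc j)
        ≡⟨ cong (_+ newMaxSum i (suc j))
                (completions≡ballot l i j (viable-gap V (subst (strictSup p ≤_) sup+i≡n (m≤m+n (strictSup p) i)) g)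
                                    (proj₁ (gap-snoc-shape g sup+i≡n len+j≡sup)) (proj₂ (gap-snoc-shape g sup+i≡n len+j≡sup))
                                    (suc-injective (trans (sym (+-suc i j)) i+j≡1+l))) ⟩
      ballot i j + newMaxSum i (suc j)
        ≡⟨ sym (ballot-suc i j) ⟩
      ballot i (suc j) ∎
      where
      open ≡-Reasoning
      open LargestGap g

    completions-new-max : ∀ l {p} i j → Viable p → strictSup p + i ≡ n → length p + j ≡ strictSup p → i + j ≡ suc l →
      ∑< i (λ t → completions (p ++ [ strictSup p + t ]) l) ≡ newMaxSum i j
    completions-new-max l {p} i j V sup+i≡n len+j≡sup i+j≡1+l = ∑<-cong i child
      where
      sup : ℕ
      sup = strictSup p
      child : ∀ {t} → t < i → completions (p ++ [ sup + t ]) l ≡ ballot (i ∸ suc t) (j + t)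
      child {t} t<i = completions≡ballot l (i ∸ suc t) (j + t)
        (viable-new-max V (m≤m+n sup t) (subst (sup + t <_) sup+i≡n (+-monoʳ-< sup t<i)))
        (trans (cong (_+ (i ∸ suc t)) sup′≡1+sup+t) (new-max-sup 1+t+d≡i sup+i≡n))
        (trans (cong (_+ (j + t)) (length-++ p))
               (trans (new-max-length {length p} {j} {sup} {t} len+j≡sup) (sym sup′≡1+sup+t)))
        (new-max-rest {t} {i ∸ suc t} 1+t+d≡i i+j≡1+l)
        where
        1+t+d≡i : suc t + (i ∸ suc t) ≡ i
        1+t+d≡i = m+[n∸m]≡n t<i
        sup′≡1+sup+t : strictSup (p ++ [ sup + t ]) ≡ suc (sup + t)
        sup′≡1+sup+t = trans (strictSup-snoc p (sup + t)) (m≤n⇒m⊔n≡n (m≤n⇒m≤1+n (m≤m+n sup t)))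


-- Descents in the standard cycle form

cycleMaxima : List ℕ → List ℕ
cycleMaxima σ = filterᵇ (isCycleMax σ) (upTo (length σ))

∈-cycleMaxima⇒orbit≤ : ∀ σ {m y} → m ∈ cycleMaxima σ → y ∈ orbit σ m → y ≤ m
∈-cycleMaxima⇒orbit≤ σ {m} {y} m∈ y∈orb =
  ≤ᵇ⇒≤ y m (All.lookup (all⁺ (_≤ᵇ m) (orbit σ m) (proj₂ (∈-filter⁻ (T? ∘ isCycleMax σ) {xs = upTo (length σ)} m∈))) y∈orb)

orbitFrom-adjacent : ∀ fuel σ m y {z} → z ∈ y ∷ orbitFrom fuel σ m (at σ y) →
  Adjacent z (at σ z) (y ∷ orbitFrom fuel σ m (at σ y)) ⊎ at σ z ≡ m ⊎ length (orbitFrom fuel σ m (at σ y)) ≡ fuel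
orbitFrom-adjacent zero    σ m y (here refl) = inj₂ (inj₂ refl)
orbitFrom-adjacent (suc f) σ m y z∈ with at σ y ≡ᵇ m | ≡ᵇ⇒≡ (at σ y) m
orbitFrom-adjacent (suc f) σ m y (here refl) | true  | σy≡m = inj₂ (inj₁ (σy≡m _))
orbitFrom-adjacent (suc f) σ m y (here refl) | false | _    = inj₁ here
orbitFrom-adjacent (suc f) σ m y (there z∈)  | false | _ with orbitFrom-adjacent f σ m (at σ y) z∈
... | inj₁ adj             = inj₁ (there adj)
... | inj₂ (inj₁ σz≡m)     = inj₂ (inj₁ σz≡m)
... | inj₂ (inj₂ len≡f)    = inj₂ (inj₂ (cong suc len≡f))

-- The length hypothesis keeps `orbit` from exhausting its fuel: every orbit is an infix of θ σ.
θ-descent : ∀ σ {z} → length (θ σ) ≤ length σ → z ∈ θ σ → at σ z < z → Adjacent z (at σ z) (θ σ)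
θ-descent σ {z} len≤ z∈θ σz<z with ∈-concat⁻′ (map (orbit σ) (cycleMaxima σ)) z∈θ
... | orb , z∈orb , orb∈ with ∈-map⁻ (orbit σ) orb∈
...   | m , m∈maxima , refl with infix-of-concat orb∈
...     | U , V , θ≡ with orbitFrom-adjacent (length σ) σ m m z∈orb
...       | inj₁ adj         = subst (Adjacent z (at σ z)) (sym θ≡) (adjacent-++⁺ʳ U (adjacent-++⁺ˡ V adj))
...       | inj₂ (inj₁ σz≡m) = ⊥-elim (<⇒≱ σz<z (subst (z ≤_) (sym σz≡m) (∈-cycleMaxima⇒orbit≤ σ m∈maxima z∈orb)))
...       | inj₂ (inj₂ len≡) = ⊥-elim (<⇒≱ (s≤s (≤-reflexive (sym len≡))) (≤-trans orbit≤θ len≤))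
  where
  orbit≤θ : length (orbit σ m) ≤ length (θ σ)
  orbit≤θ = subst (λ w → length (orbit σ m) ≤ length w) (sym θ≡) (length-infix U (orbit σ m) V)

Follows : List ℕ → List (ℕ × ℕ) → Set
Follows σ = All (λ (u , w) → at σ u ≡ w)

follows-suffix : ∀ σ {z y ys} xs → Follows σ (links (xs ++ y ∷ ys) z) → Follows σ (links (y ∷ ys) z)
follows-suffix σ []            follows       = follows
follows-suffix σ (x ∷ [])      (_ ∷ follows) = follows
follows-suffix σ (x ∷ x′ ∷ xs) (_ ∷ follows) = follows-suffix σ (x′ ∷ xs) follows

orbitFrom-self : ∀ fuel σ m → orbitFrom fuel σ m m ≡ []
orbitFrom-self zero       σ m = refl
orbitFrom-self (suc fuel) σ m with m ≡ᵇ m | ≡⇒≡ᵇ m m refl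
... | true | _ = refl

orbitFrom-∋-start : ∀ fuel σ m y → 0 < fuel → y ≢ m → y ∈ orbitFrom fuel σ m y
orbitFrom-∋-start (suc fuel) σ m y _ y≢m with y ≡ᵇ m | ≡ᵇ⇒≡ y m
... | false | _   = here refl
... | true  | y≡m = ⊥-elim (y≢m (y≡m _))

orbitFrom-follows : ∀ fuel σ m y ys z → Follows σ (links (y ∷ ys) z) → All (_≢ m) ys → length ys ≤ fuel →
  orbitFrom fuel σ m (at σ y) ≡ ys ++ orbitFrom (fuel ∸ length ys) σ m z
orbitFrom-follows fuel    σ m y []       z (σy≡z ∷ []) _ _ = cong (orbitFrom fuel σ m) σy≡z
orbitFrom-follows (suc f) σ m y (v ∷ ys) z (σy≡v ∷ follows) (v≢m ∷ ys≢m) (s≤s len≤) with at σ y | σy≡v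
... | _ | refl with v ≡ᵇ m | ≡ᵇ⇒≡ v m
...   | false | _   = cong (v ∷_) (orbitFrom-follows f σ m v ys z follows ys≢m len≤)
...   | true  | v≡m = ⊥-elim (v≢m (v≡m _))


-- Inverting the fundamental bijection

Block : Set
Block = ℕ × List ℕ

flatten : List Block → List ℕ
flatten = concatMap (λ (h , t) → h ∷ t)

heads : List Block → List ℕ
heads = map proj₁

-- The blocks of π cut before each left-to-right maximum; they are the cycles of θ⁻¹ π.
data MaxBlocks : List Block → Set where
  []    : MaxBlocks []
  block : ∀ {h t bs} → All (_≤ h) t → All (h <_) (heads bs) → MaxBlocks bs → MaxBlocks ((h , t) ∷ bs)

maxBlocks⇒ascending : ∀ {bs} → MaxBlocks bs → Ascending (heads bs)
maxBlocks⇒ascending []                     = []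
maxBlocks⇒ascending (block _ h<bs bs-blocks) = h<bs ∷ maxBlocks⇒ascending bs-blocks

maxBlocks-tail≤ : ∀ {bs h t} → MaxBlocks bs → (h , t) ∈ bs → All (_≤ h) t
maxBlocks-tail≤ (block t≤h _ _)    (here refl)  = t≤h
maxBlocks-tail≤ (block _ _ bs-blocks) (there b∈) = maxBlocks-tail≤ bs-blocks b∈

record Absorption (x : ℕ) (bs : List Block) : Set where
  field
    absorbed  : List ℕ
    rest      : List Block
    split     : flatten bs ≡ absorbed ++ flatten rest
    absorbed≤ : All (_≤ x) absorbed
    <rest     : All (x <_) (heads rest)
    restBlocks : MaxBlocks rest

absorb : ∀ x {bs} → MaxBlocks bs → Absorption x bs
absorb x [] = record { absorbed = [] ; rest = [] ; split = refl ; absorbed≤ = [] ; <rest = [] ; restBlocks = [] }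
absorb x (block {h} {t} {bs} t≤h h<bs bs-blocks) with h ≤? x
... | yes h≤x = record
  { absorbed = h ∷ t ++ absorbed ; rest = rest ; restBlocks = restBlocks ; <rest = <rest
  ; split = cong (h ∷_) (trans (cong (t ++_) split) (sym (++-assoc t absorbed (flatten rest))))
  ; absorbed≤ = h≤x ∷ All-++⁺ (All.map (λ y≤h → ≤-trans y≤h h≤x) t≤h) absorbed≤ }
  where open Absorption (absorb x bs-blocks)
... | no h≰x = record
  { absorbed = [] ; rest = (h , t) ∷ bs ; split = refl ; absorbed≤ = []
  ; <rest = x<h ∷ All.map (<-trans x<h) h<bs ; restBlocks = block t≤h h<bs bs-blocks }
  where
  x<h : x < h
  x<h = ≰⇒> h≰x

record Decomposition (π : List ℕ) : Set where
  field
    blocks    : List Block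
    flatten≡  : flatten blocks ≡ π
    maxBlocks : MaxBlocks blocks

decompose : ∀ π → Decomposition π
decompose []      = record { blocks = [] ; flatten≡ = refl ; maxBlocks = [] }
decompose (x ∷ π) = record
  { blocks    = (x , absorbed) ∷ rest
  ; flatten≡  = cong (x ∷_) (trans (sym split) flatten≡)
  ; maxBlocks = block absorbed≤ <rest restBlocks }
  where
  open Decomposition (decompose π)
  open Absorption (absorb x maxBlocks)

cyclePairs : List Block → List (ℕ × ℕ)
cyclePairs = concatMap (λ (h , t) → links (h ∷ t) h)

keys-cyclePairs : ∀ bs → map proj₁ (cyclePairs bs) ≡ flatten bs
keys-cyclePairs []             = refl
keys-cyclePairs ((h , t) ∷ bs) =
  trans (map-++ proj₁ (links (h ∷ t) h) _) (cong₂ _++_ (keys-links (h ∷ t) h) (keys-cyclePairs bs))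

values↭keys-cyclePairs : ∀ bs → map proj₂ (cyclePairs bs) ↭ map proj₁ (cyclePairs bs)
values↭keys-cyclePairs []             = ↭-refl
values↭keys-cyclePairs ((h , t) ∷ bs) = begin
  map proj₂ (links (h ∷ t) h ++ cyclePairs bs)             ≡⟨ map-++ proj₂ (links (h ∷ t) h) _ ⟩
  map proj₂ (links (h ∷ t) h) ++ map proj₂ (cyclePairs bs) ≡⟨ cong (_++ _) (values-links h t h) ⟩
  (t ++ [ h ]) ++ map proj₂ (cyclePairs bs)                 ↭⟨ ↭-++⁺ (↭-sym (∷↭∷ʳ h t)) (values↭keys-cyclePairs bs) ⟩
  (h ∷ t) ++ map proj₁ (cyclePairs bs)                      ≡⟨ cong (_++ _) (sym (keys-links (h ∷ t) h)) ⟩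
  map proj₁ (links (h ∷ t) h) ++ map proj₁ (cyclePairs bs) ≡⟨ sym (map-++ proj₁ (links (h ∷ t) h) _) ⟩
  map proj₁ (links (h ∷ t) h ++ cyclePairs bs)             ∎
  where open PermutationReasoning

descent⇒∈cyclePairs : ∀ {bs u v} → MaxBlocks bs → Adjacent u v (flatten bs) → v < u → (u , v) ∈ cyclePairs bs
descent⇒∈cyclePairs {(h , t) ∷ bs} (block t≤h h<bs bs-blocks) adj v<u with adjacent-++⁻ (h ∷ t) adj
... | inj₁ adj-block = ∈-++⁺ˡ (adjacent⇒∈links h adj-block)
... | inj₂ (inj₂ adj-rest) = ∈-++⁺ʳ (links (h ∷ t) h) (descent⇒∈cyclePairs bs-blocks adj-rest v<u)
... | inj₂ (inj₁ (u∈block , _ , flatten≡v∷)) =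
  ⊥-elim (<-asym v<u (≤-<-trans (block≤head u∈block) (h<next bs h<bs flatten≡v∷)))
  where
  block≤head : ∀ {y} → y ∈ h ∷ t → y ≤ h
  block≤head (here refl) = ≤-refl
  block≤head (there y∈t) = All.lookup t≤h y∈t
  h<next : ∀ bs′ {v rest} → All (h <_) (heads bs′) → flatten bs′ ≡ v ∷ rest → h < v
  h<next ((h′ , t′) ∷ _) (h<h′ ∷ _) refl = h<h′

lookupᵃ : List (ℕ × ℕ) → ℕ → ℕ
lookupᵃ []              v = 0
lookupᵃ ((k , w) ∷ kws) v = if v ≡ᵇ k then w else lookupᵃ kws v

lookupᵃ-∈ : ∀ kws {k w} → Unique (map proj₁ kws) → (k , w) ∈ kws → lookupᵃ kws k ≡ w
lookupᵃ-∈ ((k , w) ∷ kws) _ (here refl) with k ≡ᵇ k | ≡⇒≡ᵇ k k refl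
... | true | _ = refl
lookupᵃ-∈ ((k′ , w′) ∷ kws) {k} (k′∉ ∷ u) (there kw∈) with k ≡ᵇ k′ | ≡ᵇ⇒≡ k k′
... | false | _    = lookupᵃ-∈ kws u kw∈
... | true  | k≡k′ = ⊥-elim (All¬⇒¬Any k′∉ (subst (_∈ map proj₁ kws) (k≡k′ _) (∈-map⁺ proj₁ kw∈)))

unique-values⇒≡ : ∀ {kws : List (ℕ × ℕ)} {u v w} → Unique (map proj₂ kws) → (u , w) ∈ kws → (v , w) ∈ kws → u ≡ v
unique-values⇒≡ _          (here refl) (here refl) = refl
unique-values⇒≡ (w∉ ∷ _)   (here refl) (there vw∈) = ⊥-elim (All¬⇒¬Any w∉ (∈-map⁺ proj₂ vw∈))
unique-values⇒≡ (w∉ ∷ _)   (there uw∈) (here refl) = ⊥-elim (All¬⇒¬Any w∉ (∈-map⁺ proj₂ uw∈))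
unique-values⇒≡ (_ ∷ u)    (there uw∈) (there vw∈) = unique-values⇒≡ u uw∈ vw∈

module Reconstruction {n π} (π-perm : IsPermutation n π) where

  open IsPermutation π-perm
  open Decomposition (decompose π)

  pairs : List (ℕ × ℕ)
  pairs = cyclePairs blocks

  keys≡π : map proj₁ pairs ≡ π
  keys≡π = trans (keys-cyclePairs blocks) flatten≡

  unique-keys : Unique (map proj₁ pairs)
  unique-keys = subst Unique (sym keys≡π) unique

  unique-values : Unique (map proj₂ pairs)
  unique-values = Unique-resp-↭ (↭⇒↭ₛ (↭-sym (values↭keys-cyclePairs blocks))) unique-keys

  successor : ℕ → ℕ
  successor = lookupᵃ pairs

  σ : List ℕ
  σ = map successor (upTo n)

  length-σ : length σ ≡ n
  length-σ = trans (length-map successor (upTo n)) (length-upTo n)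

  successor-pair : ∀ {v} → v ∈ π → (v , successor v) ∈ pairs
  successor-pair v∈π with ∈-map⁻ proj₁ (subst (_ ∈_) (sym keys≡π) v∈π)
  ... | (k , w) , kw∈ , refl = subst (λ w′ → (k , w′) ∈ pairs) (sym (lookupᵃ-∈ pairs unique-keys kw∈)) kw∈

  at-σ : ∀ {u w} → (u , w) ∈ pairs → at σ u ≡ w
  at-σ {u} uw∈ =
    trans (at-map-applyUpTo successor (λ i → i) n (All.lookup bounded u∈π)) (lookupᵃ-∈ pairs unique-keys uw∈)
    where
    u∈π : u ∈ π
    u∈π = subst (u ∈_) keys≡π (∈-map⁺ proj₁ uw∈)

  σ-perm : IsPermutation n σ
  σ-perm = record
    { unique  = unique-map⁺ injective (upTo⁺ n)
    ; bounded = All-map⁺ (All.tabulate λ v∈ → All.lookup bounded (successor∈π (permutation-∋ π-perm (∈-upTo⁻ v∈))))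
    ; length≡ = length-σ }
    where
    injective : ∀ {u v} → u ∈ upTo n → v ∈ upTo n → successor u ≡ successor v → u ≡ v
    injective u∈ v∈ su≡sv = unique-values⇒≡ unique-values (successor-pair (permutation-∋ π-perm (∈-upTo⁻ u∈)))
      (subst (λ w → (_ , w) ∈ pairs) (sym su≡sv) (successor-pair (permutation-∋ π-perm (∈-upTo⁻ v∈))))
    successor∈π : ∀ {v} → v ∈ π → successor v ∈ π
    successor∈π {v} v∈π = subst (successor v ∈_) keys≡π
      (∈-resp-↭ (values↭keys-cyclePairs blocks) (∈-map⁺ proj₂ (successor-pair v∈π)))

  module _ {h t} (block∈ : (h , t) ∈ blocks) where

    block-infix : ∃₂ λ U V → π ≡ U ++ (h ∷ t) ++ V
    block-infix with infix-of-concat (∈-map⁺ (λ (h , t) → h ∷ t) block∈)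
    ... | U , V , flatten≡U++V = U , V , trans (sym flatten≡) flatten≡U++V

    block-unique : Unique (h ∷ t)
    block-unique with block-infix
    ... | U , V , π≡ = unique-++⁻ˡ (h ∷ t) (unique-++⁻ʳ U (subst Unique π≡ unique))

    block-length : length (h ∷ t) ≤ n
    block-length with block-infix
    ... | U , V , π≡ = subst (length (h ∷ t) ≤_) (trans (cong length (sym π≡)) length≡) (length-infix U (h ∷ t) V)

    block-follows : Follows σ (links (h ∷ t) h)
    block-follows = All.tabulate λ uw∈ → at-σ (∈-concatMap⁺ (λ (h , t) → links (h ∷ t) h) (lose block∈ uw∈))

    orbit-head : orbit σ h ≡ h ∷ t
    orbit-head = cong (h ∷_) (begin
      orbitFrom (length σ) σ h (at σ h)
        ≡⟨ cong (λ k → orbitFrom k σ h (at σ h)) length-σ ⟩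
      orbitFrom n σ h (at σ h)
        ≡⟨ orbitFrom-follows n σ h h t h block-follows t≢h (≤-trans (n≤1+n _) block-length) ⟩
      t ++ orbitFrom (n ∸ length t) σ h h
        ≡⟨ cong (t ++_) (orbitFrom-self (n ∸ length t) σ h) ⟩
      t ++ []
        ≡⟨ ++-identityʳ t ⟩
      t ∎)
      where
      open ≡-Reasoning
      t≢h : All (_≢ h) t
      t≢h with block-unique
      ... | h∉t ∷ _ = All.map ≢-sym h∉t

    orbit-tail∋head : ∀ {v} → v ∈ t → h ∈ orbit σ v
    orbit-tail∋head {v} v∈t with ∈-∃++ v∈t | block-unique
    ... | P , R , refl | h∉t ∷ u-t =
      there (subst (h ∈_) (sym orbitFrom≡) (∈-++⁺ʳ R (orbitFrom-∋-start _ σ v h (m<n⇒0<n∸m R<n) h≢v)))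
      where
      h≢v : h ≢ v
      h≢v = All.lookup h∉t v∈t
      R≢v : All (_≢ v) R
      R≢v with unique-++⁻ʳ P u-t
      ... | v∉R ∷ _ = All.map ≢-sym v∉R
      R<n : length R < n
      R<n = ≤-trans (s≤s (≤-trans (n≤1+n _) (length-++-≤ʳ (v ∷ R) {P}))) block-length
      orbitFrom≡ : orbitFrom (length σ) σ v (at σ v) ≡ R ++ orbitFrom (n ∸ length R) σ v h
      orbitFrom≡ = trans (cong (λ k → orbitFrom k σ v (at σ v)) length-σ)
                         (orbitFrom-follows n σ v v R h (follows-suffix σ (h ∷ P) block-follows) R≢v (<⇒≤ R<n))

    tail-not-cycleMax : ∀ {v} → v ∈ t → ¬ T (isCycleMax σ v)
    tail-not-cycleMax {v} v∈t v-max =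
      <⇒≱ v<h (≤ᵇ⇒≤ h v (All.lookup (all⁺ (_≤ᵇ v) (orbit σ v) v-max) (orbit-tail∋head v∈t)))
      where
      v<h : v < h
      v<h with block-unique
      ... | h∉t ∷ _ = ≤∧≢⇒< (All.lookup (maxBlocks-tail≤ maxBlocks block∈) v∈t) (≢-sym (All.lookup h∉t v∈t))

    head-cycleMax : T (isCycleMax σ h)
    head-cycleMax = subst (T ∘ all (_≤ᵇ h)) (sym orbit-head)
      (all⁻ (_≤ᵇ h) {h ∷ t} (≤⇒≤ᵇ (≤-refl {h}) ∷ All.map ≤⇒≤ᵇ (maxBlocks-tail≤ maxBlocks block∈)))

  cycleMaxima≡heads : cycleMaxima σ ≡ heads blocks
  cycleMaxima≡heads = ascending-≡ (AllPairs.filter⁺ (T? ∘ isCycleMax σ) (upTo-ascending (length σ)))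
                                  (maxBlocks⇒ascending maxBlocks) max⇒head head⇒max
    where
    max⇒head : ∀ {z} → z ∈ cycleMaxima σ → z ∈ heads blocks
    max⇒head {z} z∈ with ∈-filter⁻ (T? ∘ isCycleMax σ) {xs = upTo (length σ)} z∈
    ... | z∈upTo , z-max with find (∈-concatMap⁻ (λ (h , t) → h ∷ t) {xs = blocks}
                               (subst (z ∈_) (sym flatten≡) (permutation-∋ π-perm (subst (z <_) length-σ (∈-upTo⁻ z∈upTo)))))
    ...   | (h , t) , block∈ , here refl = ∈-map⁺ proj₁ block∈
    ...   | (h , t) , block∈ , there z∈t = ⊥-elim (tail-not-cycleMax block∈ z∈t z-max)
    head⇒max : ∀ {z} → z ∈ heads blocks → z ∈ cycleMaxima σ
    head⇒max z∈ with ∈-map⁻ proj₁ z∈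
    ... | (h , t) , block∈ , refl = ∈-filter⁺ (T? ∘ isCycleMax σ)
      (∈-upTo⁺ (subst (h <_) (sym length-σ) (All.lookup bounded
        (subst (h ∈_) flatten≡ (∈-concatMap⁺ (λ (h , t) → h ∷ t) (lose block∈ (here refl)))))))
      (head-cycleMax block∈)

  θσ≡π : θ σ ≡ π
  θσ≡π = begin
    concat (map (orbit σ) (cycleMaxima σ))     ≡⟨ cong (concat ∘ map (orbit σ)) cycleMaxima≡heads ⟩
    concat (map (orbit σ) (map proj₁ blocks))  ≡⟨ cong concat (sym (map-∘ blocks)) ⟩
    concat (map (orbit σ ∘ proj₁) blocks)
      ≡⟨ cong concat (map-cong-local {xs = blocks} (All.tabulate λ { {h , t} block∈ → orbit-head block∈ })) ⟩
    flatten blocks                             ≡⟨ flatten≡ ⟩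
    π                                          ∎
    where open ≡-Reasoning

  σ-descent : ∀ {u v} → Adjacent u v π → v < u → at σ u ≡ v
  σ-descent {u} {v} adj v<u = at-σ (descent⇒∈cyclePairs maxBlocks (subst (Adjacent u v) (sym flatten≡) adj) v<u)


-- The arrow pattern (12 ; 3 → 1) versus 312

-- The second conjunct tested by `containsᵇ π pat12-3→1` for each σ.
arrowWitnessᵇ : List ℕ → List ℕ → Bool
arrowWitnessᵇ π σ =
  any (λ X → isSubseqᵇ (map (xAt X) (1 ∷ 2 ∷ [])) π ∧ all (λ (b , c) → at σ (xAt X b) ≡ᵇ xAt X c) ((3 , 1) ∷ []))
      (choose 3 (upTo (length π)))

-- `containsᵇ` tests θ σ = π with a function local to its where-block, which cannot be named.
-- The metavariable `listEqᶜ` is solved to it (as a function of the enclosing π) by the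
-- unification problem in `pin`, where generalising over x ∷ xs separates that enclosing π
-- from the list being compared.
mutual
  listEqᶜ : List ℕ → List ℕ → List ℕ → Bool
  listEqᶜ = _

  private
    compareθ : List ℕ → List ℕ → Bool
    compareθ π = proj₁ unfold
      where
      unfold : Σ (List ℕ → Bool) λ g → containsᵇ π pat12-3→1 ≡ any (λ σ → g σ ∧ arrowWitnessᵇ π σ) (perms (length π))
      unfold = _ , refl

    pin : ∀ π σ → Σ Bool (compareθ π σ ≡_)
    pin π σ with θ σ
    pin []       σ | _      = _ , refl
    pin (_ ∷ _)  σ | []     = _ , refl
    pin (x ∷ xs) σ | y ∷ ys with x ∷ xs
    ... | R = (y ≡ᵇ x) ∧ listEqᶜ R ys xs , refl

listEqᶜ⇒≡ : ∀ R w v → T (listEqᶜ R w v) → w ≡ v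
listEqᶜ⇒≡ R []       []       _ = refl
listEqᶜ⇒≡ R (y ∷ w)  (x ∷ v)  h with T-∧ .Equivalence.to h
... | y≡ᵇx , w≈v = cong₂ _∷_ (≡ᵇ⇒≡ y x y≡ᵇx) (listEqᶜ⇒≡ R w v w≈v)

listEqᶜ-refl : ∀ R w → T (listEqᶜ R w w)
listEqᶜ-refl R []      = _
listEqᶜ-refl R (x ∷ w) = T-∧ .Equivalence.from (≡⇒≡ᵇ x x refl , listEqᶜ-refl R w)

record ArrowOccurrence (π σ : List ℕ) : Set where
  constructor arrowOccurrence
  field
    {x₁ x₂ x₃} : ℕ
    x₁<x₂      : x₁ < x₂
    x₂<x₃      : x₂ < x₃
    x₃<n       : x₃ < length π
    occurs     : x₁ ∷ x₂ ∷ [] ⊆ π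
    σx₃≡x₁     : at σ x₃ ≡ x₁

arrowWitnessᵇ⇒occurrence : ∀ π σ → T (arrowWitnessᵇ π σ) → ArrowOccurrence π σ
arrowWitnessᵇ⇒occurrence π σ h with find (any⁻ _ (choose 3 (upTo (length π))) h)
... | X , X∈ , hX with ∈-choose⁻ 3 (upTo (length π)) X∈
...   | X⊆upTo , len≡3 = occurrence X X⊆upTo len≡3 hX
  where
  occurrence : ∀ X → X ⊆ upTo (length π) → length X ≡ 3 →
    T (isSubseqᵇ (map (xAt X) (1 ∷ 2 ∷ [])) π ∧ ((at σ (xAt X 3) ≡ᵇ xAt X 1) ∧ true)) → ArrowOccurrence π σ
  occurrence (x₁ ∷ x₂ ∷ x₃ ∷ []) X⊆upTo refl hX
    with ascending-⊆ X⊆upTo (upTo-ascending (length π)) | T-∧ .Equivalence.to hX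
  ... | (x₁<x₂ ∷ _) ∷ (x₂<x₃ ∷ []) ∷ _ | sub , σx₃≈x₁ =
    arrowOccurrence x₁<x₂ x₂<x₃ (∈-upTo⁻ (Sublist.lookup X⊆upTo (there (there (here refl)))))
                    (isSubseqᵇ⇒⊆ _ π sub) (≡ᵇ⇒≡ _ _ (proj₁ (T-∧ .Equivalence.to σx₃≈x₁)))

occurrence⇒arrowWitnessᵇ : ∀ {π σ} → ArrowOccurrence π σ → T (arrowWitnessᵇ π σ)
occurrence⇒arrowWitnessᵇ {π} {σ} (arrowOccurrence {x₁} {x₂} {x₃} x₁<x₂ x₂<x₃ x₃<n occurs σx₃≡x₁) =
  any⁺ _ (lose (∈-choose⁺ X⊆upTo) (T-∧ .Equivalence.from (⊆⇒isSubseqᵇ occurs , T-∧ .Equivalence.from (≡⇒≡ᵇ _ _ σx₃≡x₁ , _))))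
  where
  X⊆upTo : x₁ ∷ x₂ ∷ x₃ ∷ [] ⊆ upTo (length π)
  X⊆upTo = ascending⇒⊆upTo ((x₁<x₂ ∷ <-trans x₁<x₂ x₂<x₃ ∷ []) ∷ (x₂<x₃ ∷ []) ∷ [] ∷ [])
                           (<-trans (<-trans x₁<x₂ x₂<x₃) x₃<n ∷ <-trans x₂<x₃ x₃<n ∷ x₃<n ∷ [])

record ContainsArrow (π : List ℕ) : Set where
  field
    σ          : List ℕ
    σ-perm     : IsPermutation (length π) σ
    θσ≡π       : θ σ ≡ π
    occurrence : ArrowOccurrence π σ

containsᵇ⇒arrow : ∀ π → T (containsᵇ π pat12-3→1) → ContainsArrow π
containsᵇ⇒arrow π h with find (any⁻ _ (perms (length π)) h)
... | σ , σ∈ , hσ with T-∧ .Equivalence.to hσ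
...   | θσ≈π , witness = record
  { σ = σ ; σ-perm = ∈-perms⁻ σ∈ ; θσ≡π = listEqᶜ⇒≡ π (θ σ) π θσ≈π
  ; occurrence = arrowWitnessᵇ⇒occurrence π σ witness }

arrow⇒containsᵇ : ∀ {π} → ContainsArrow π → T (containsᵇ π pat12-3→1)
arrow⇒containsᵇ {π} arrow = any⁺ _ (lose (∈-perms⁺ σ-perm)
  (T-∧ .Equivalence.from ( subst (λ w → T (listEqᶜ π w π)) (sym θσ≡π) (listEqᶜ-refl π π)
                         , occurrence⇒arrowWitnessᵇ occurrence)))
  where open ContainsArrow arrow

arrow⇒312 : ∀ {π} → IsPermutation (length π) π → ContainsArrow π → Contains312 π
arrow⇒312 {π} π-perm record { σ = σ ; σ-perm = σ-perm ; θσ≡π = θσ≡π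
                            ; occurrence = arrowOccurrence {x₁} {x₂} {x₃} x₁<x₂ x₂<x₃ x₃<n occurs σx₃≡x₁ } =
  contains312 x₁<x₂ x₂<x₃ (adjacent-⊆ x₃x₁-adjacent (IsPermutation.unique π-perm) occurs)
  where
  x₃x₁-adjacent : Adjacent x₃ x₁ π
  x₃x₁-adjacent = subst₂ (Adjacent x₃) σx₃≡x₁ θσ≡π
    (θ-descent σ (≤-reflexive (trans (cong length θσ≡π) (sym (IsPermutation.length≡ σ-perm))))
                 (subst (x₃ ∈_) (sym θσ≡π) (permutation-∋ π-perm x₃<n))
                 (subst (_< x₃) (sym σx₃≡x₁) (<-trans x₁<x₂ x₂<x₃)))

record AdjacentDescent (π : List ℕ) : Set where
  field
    {x₁ x₂ x₃} : ℕ
    adjacent   : Adjacent x₃ x₁ π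
    x₁<x₂      : x₁ < x₂
    x₂<x₃      : x₂ < x₃
    x₁∷x₂⊆π    : x₁ ∷ x₂ ∷ [] ⊆ π

adjacentDescent-∷ : ∀ {π} x → AdjacentDescent π → AdjacentDescent (x ∷ π)
adjacentDescent-∷ x d = record { adjacent = there adjacent ; x₁<x₂ = x₁<x₂ ; x₂<x₃ = x₂<x₃ ; x₁∷x₂⊆π = x ∷ʳ x₁∷x₂⊆π }
  where open AdjacentDescent d

descent-after : ∀ {x₃ x₁ x₂} L → Unique (x₃ ∷ L) → x₁ < x₂ → x₂ < x₃ → x₁ ∷ x₂ ∷ [] ⊆ L → AdjacentDescent (x₃ ∷ L)
descent-after {x₃} {x₁} {x₂} (v ∷ L) u x₁<x₂ x₂<x₃ occ with <-cmp v x₂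
... | tri< v<x₂ _ _ = record { adjacent = here ; x₁<x₂ = v<x₂ ; x₂<x₃ = x₂<x₃ ; x₁∷x₂⊆π = x₃ ∷ʳ refl ∷ from∈ (x₂∈L occ) }
  where
  x₂∈L : x₁ ∷ x₂ ∷ [] ⊆ v ∷ L → x₂ ∈ L
  x₂∈L (_ ∷ʳ occ′) = to∈ (∷ˡ⁻ occ′)
  x₂∈L (_ ∷ occ′)  = to∈ occ′
... | tri≈ _ refl _ with occ | u
...   | refl ∷ _   | _              = ⊥-elim (<-irrefl refl x₁<x₂)
...   | _ ∷ʳ occ′  | _ ∷ (v∉L ∷ _)  = ⊥-elim (All¬⇒¬Any v∉L (to∈ (∷ˡ⁻ occ′)))
descent-after (v ∷ L) u x₁<x₂ x₂<x₃ occ | tri> _ _ x₂<v with occ | u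
...   | refl ∷ _   | _      = ⊥-elim (<-asym x₁<x₂ x₂<v)
...   | _ ∷ʳ occ′  | _ ∷ uL = adjacentDescent-∷ _ (descent-after L uL x₁<x₂ x₂<v occ′)

312⇒adjacentDescent : ∀ {π} → Unique π → Contains312 π → AdjacentDescent π
312⇒adjacentDescent (_ ∷ uπ) (contains312 x₁<x₂ x₂<x₃ (y ∷ʳ occ)) =
  adjacentDescent-∷ y (312⇒adjacentDescent uπ (contains312 x₁<x₂ x₂<x₃ occ))
312⇒adjacentDescent uπ       (contains312 x₁<x₂ x₂<x₃ (refl ∷ occ)) = descent-after _ uπ x₁<x₂ x₂<x₃ occ

312⇒arrow : ∀ {π} → IsPermutation (length π) π → Contains312 π → ContainsArrow π
312⇒arrow {π} π-perm c312 = record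
  { σ = σ ; σ-perm = σ-perm ; θσ≡π = θσ≡π
  ; occurrence = arrowOccurrence x₁<x₂ x₂<x₃ (All.lookup (IsPermutation.bounded π-perm) (adjacent⇒∈ˡ adjacent))
                                 x₁∷x₂⊆π (σ-descent adjacent (<-trans x₁<x₂ x₂<x₃)) }
  where
  open Reconstruction π-perm
  open AdjacentDescent (312⇒adjacentDescent (IsPermutation.unique π-perm) c312)

avoidsᵇ⇔¬312 : ∀ {π} → IsPermutation (length π) π → T (avoidsᵇ π pat12-3→1) ⇔ (¬ Contains312 π)
avoidsᵇ⇔¬312 {π} π-perm with containsᵇ π pat12-3→1 | containsᵇ⇒arrow π | arrow⇒containsᵇ {π}
... | true  | ⇒arrow | _      = mk⇔ (λ ()) (λ ¬312 → ¬312 (arrow⇒312 π-perm (⇒arrow _)))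
... | false | _      | arrow⇒ = mk⇔ (λ _ c312 → arrow⇒ (312⇒arrow π-perm c312)) (λ _ → _)


a≡completions : ∀ n → a n pat12-3→1 ≡ Completions.completions n [] n
a≡completions n = cong length (trans (filter-filter (T? ∘ avoidsᵇ′) (T? ∘ distinctᵇ) (allLists n n))
                                     (filter-cong-local _ avoider? same-predicate))
  where
  avoidsᵇ′ : List ℕ → Bool
  avoidsᵇ′ π = avoidsᵇ π pat12-3→1
  same-predicate : ∀ {w} → w ∈ allLists n n → (T (distinctᵇ w) × T (avoidsᵇ′ w)) ⇔ Avoider w
  same-predicate {w} w∈ with ∈-allLists⁻ n n w∈
  ... | len , w<n = mk⇔
    (λ (dist , avoids) → let u = distinctᵇ⇒unique w dist in u , Equivalence.to (avoidsᵇ⇔¬312 (perm u)) avoids)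
    (λ (u , ¬312) → unique⇒distinctᵇ u , Equivalence.from (avoidsᵇ⇔¬312 (perm u)) ¬312)
    where
    perm : Unique w → IsPermutation (length w) w
    perm u = record { unique = u ; bounded = subst (λ k → All (_< k) w) (sym len) w<n ; length≡ = refl }

completions-[]≡ballot : ∀ n → Completions.completions n [] n ≡ ballot n 0
completions-[]≡ballot n = completions≡ballot n n 0 viable-[] refl refl (+-identityʳ n)
  where
  open Completions n
  viable-[] : Viable []
  viable-[] = record { unique = [] ; bounded = [] ; avoids = λ { (contains312 _ _ ()) } ; untrapped = λ () }

proposition3p7 : (n : ℕ) → 1 ≤ n → a n pat12-3→1 ≡ catalan n
proposition3p7 n _ = begin
  a n pat12-3→1                   ≡⟨ a≡completions n ⟩
  Completions.completions n [] n  ≡⟨ completions-[]≡ballot n ⟩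
  ballot n 0                      ≡⟨ sym (catalan≡ballot n) ⟩
  catalan n                       ∎
  where open ≡-Reasoning
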